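{- Let $\ell\ge1$ and $0\le m\le\ell$ be integers. For every $\mu\in\mathcal F_1^m(\Lambda_\ell)$, $$\delta_2(\mu^b[1])\,\bar\delta_3(\mu)=\begin{cases}(-1)^{\binom m2}, & 0\le m\le\ell/2,\\ (-1)^{\binom{\ell-m+1}{2}+(\ell-m)m}, & \ell/2\le m\le\ell.\end{cases}$$
   Context: $\Lambda_\ell=(3\ell-2,3\ell-5,\dots,7,4,1)$. $\mathcal F_1^m(\Lambda_\ell)$ is the set of strict partitions obtained by adding $m$ nodes labelled $1$ to $\Lambda_\ell$, where the cells of each row are labelled from the left by the repeating pattern $0,1,0$ (column $j$ has label $1$ iff $j\equiv2\pmod3$); concretely it is the set of partitions $\Lambda_\ell+\sum_{i\in I}e_i$, $I\subseteq\{1,\dots,\ell\}$, $|I|=m$ (adding one box at the end of row $i$ for each $i\in I$). $r$-quotient ($r=2,3$): for a partition $\lambda=(\lambda_1,\dots,\lambda_N)$ padded with zeros so that $r\mid N$, let $\xi=\lambda+(N-1,\dots,1,0)$; for $0\le k<r$ let $\xi^{(k)}$ be the elements of $\{(\xi_i-k)/r:\xi_i\equiv k\pmod r\}$ in decreasing order, of length $N_k$, and $\lambda[k]=\xi^{(k)}-(N_k-1,\dots,1,0)$. For a strict partition $\lambda=(\lambda_1>\dots>\lambda_l>0)$, $D(\lambda)$ is the partition with Frobenius notation $(\lambda_1,\dots,\lambda_l\mid\lambda_1-1,\dots,\lambda_l-1)$ and $\lambda^b[1]:=D(\lambda)[1]$ (index $1$ component of the 3-quotient of $D(\lambda)$).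 2-sign $\delta_2(\nu)$ of a partition $\nu$ (padded with zeros to an even number $N$ of parts): place beads at positions $\xi_i=\nu_i+N-i$, arranged in two runners (runner $k$ = positions $\equiv k\pmod2$). Natural numbering: number beads $1,\dots,N$ in increasing order of position. Layer numbering: the $j$-th smallest bead on each runner forms layer $j$; number the beads layer by layer ($j=1,2,\dots$), within a layer the runner-$0$ bead before the runner-$1$ bead. $\delta_2(\nu)$ is the sign of the permutation sending each bead's natural number to its layer number. 3-bar sign $\bar\delta_3(\lambda)$ of a strict partition $\lambda$ with $l$ parts: place beads at positions $\lambda_1,\dots,\lambda_l$ in three runners (runner $k$ = positions $\equiv k\pmod 3$). Natural numbering: $1,\dots,l$ in increasing order of position. 3-bar numbering: first the beads of runner $0$ in increasing order; then, pairing the $j$-th smallest bead of runner $1$ with the $j$-th smallest bead of runner $2$ (for $j$ up to the smaller bead count), go through the pairs for increasing $j$, numbering within each pair the runner-$2$ bead before the runner-$1$ bead; finally the remaining beads in increasing order of position. $\bar\delta_3(\lambda)$ is the sign of the permutation sending each bead's natural number to its 3-bar number. -}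

module Defs where

open import Data.Bool using (Bool; true; false; if_then_else_; _∧_; _∨_; not)
open import Data.Nat using (ℕ; zero; suc; _+_; _*_; _∸_; _<ᵇ_; _≡ᵇ_; _≤ᵇ_; NonZero)
open import Data.Nat.DivMod using (_%_; _/_)
open import Data.List using (List; []; _∷_; length; map; filterᵇ; applyUpTo; zip; reverse; _++_; head)
open import Data.Nat.ListAction using (sum)
open import Data.Maybe using (just; nothing)
open import Data.Product using (_×_; _,_; proj₁; proj₂)
open import Data.Integer using (ℤ; -1ℤ; _^_)
open import Data.Fin using (Fin; toℕ)
open import Data.Fin.Subset using (Subset)
open import Data.Vec using (lookup; tabulate; toList)

count : {A : Set} → (A → Bool) → List A → ℕ
count p xs = length (filterᵇ p xs)

minℕ : ℕ → ℕ → ℕ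
minℕ a b = if a ≤ᵇ b then a else b

sgn : ℕ → ℤ
sgn k = -1ℤ ^ k

indices : ℕ → List ℕ
indices n = applyUpTo suc n

-- Beads are given by their (distinct) positions.  The natural numbering
-- numbers beads 1..N in increasing order of position.  Given another
-- numbering  num : position → ℕ  (a bijection onto 1..N), the sign of the
-- permutation  (natural number of b) ↦ num b  is (-1)^(#inversions), where
-- an inversion is a pair of beads b, c with b before c in the natural
-- numbering (pos b < pos c) but num b > num c.

inversions : List ℕ → (ℕ → ℕ) → ℕ
inversions beads num =
  sum (map (λ b → count (λ c → (b <ᵇ c) ∧ (num c <ᵇ num b)) beads) beads)

numberingSign : List ℕ → (ℕ → ℕ) → ℤ
numberingSign beads num = sgn (inversions beads num)

-- rank (0-indexed) of the bead at position p among the beads on its runner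
-- (runner = position mod r)
runnerRank : (r : ℕ) → .{{_ : NonZero r}} → List ℕ → ℕ → ℕ
runnerRank r beads p = count (λ q → ((q % r) ≡ᵇ (p % r)) ∧ (q <ᵇ p)) beads

runnerCount : (r : ℕ) → .{{_ : NonZero r}} → List ℕ → ℕ → ℕ
runnerCount r beads k = count (λ q → (q % r) ≡ᵇ k) beads

padTo : (r : ℕ) → .{{_ : NonZero r}} → List ℕ → List ℕ
padTo r xs = xs ++ applyUpTo (λ _ → 0) ((r ∸ (length xs % r)) % r)

-- ξ = λ + (N-1, ..., 1, 0) for a list λ of length N
betaNumbers : List ℕ → List ℕ
betaNumbers xs = map (λ p → proj₁ p + (length xs ∸ proj₂ p)) (zip xs (indices (length xs)))

-- ξ^(k) - (N_k - 1, ..., 1, 0) where ξ^(k) lists (ξ_i - k)/r for ξ_i ≡ k mod r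
-- (in decreasing order: ξ is strictly decreasing and filtering preserves order)
quotientComponent : (r : ℕ) → .{{_ : NonZero r}} → List ℕ → ℕ → List ℕ
quotientComponent r λs k =
  let ξ  = betaNumbers (padTo r λs)
      ξk = map (λ x → (x ∸ k) / r) (filterᵇ (λ x → (x % r) ≡ᵇ k) ξ)
      Nk = length ξk
  in map (λ p → proj₁ p ∸ (Nk ∸ proj₂ p)) (zip ξk (indices Nk))

-- Partition with Frobenius notation (a_1,...,a_l | b_1,...,b_l):
-- rows λ_i = a_i + i (i ≤ l); for l < i ≤ λ'_1 = b_1 + 1,
-- λ_i = #{ j ≤ l : b_j + j ≥ i }.

frobenius : List ℕ → List ℕ → List ℕ
frobenius as bs =
  let l   = length as
      top = map (λ p → proj₁ p + proj₂ p) (zip as (indices l))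
      bj  = zip bs (indices (length bs))
      b1  = Data.Maybe.fromMaybe 0 (head bs)
      bot = applyUpTo (λ t → count (λ p → (suc (l + t)) ≤ᵇ (proj₁ p + proj₂ p)) bj)
                      (suc b1 ∸ l)
  in top ++ bot
  where import Data.Maybe

doubleD : List ℕ → List ℕ
doubleD λs = frobenius λs (map (λ x → x ∸ 1) λs)

barQuot1 : List ℕ → List ℕ
barQuot1 λs = quotientComponent 3 (doubleD λs) 1

padEven : List ℕ → List ℕ
padEven = padTo 2

layerKeyLess : List ℕ → ℕ → ℕ → Bool
layerKeyLess beads q p =
  let jq = runnerRank 2 beads q
      jp = runnerRank 2 beads p
  in (jq <ᵇ jp) ∨ ((jq ≡ᵇ jp) ∧ ((q % 2) <ᵇ (p % 2)))

layerNumber : List ℕ → ℕ → ℕ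
layerNumber beads p = suc (count (λ q → layerKeyLess beads q p) beads)

delta2 : List ℕ → ℤ
delta2 ν = let beads = betaNumbers (padEven ν) in numberingSign beads (layerNumber beads)

-- 3-bar sign δ̄₃(λ) (beads at positions λ_1, ..., λ_l)

barNumber : List ℕ → ℕ → ℕ
barNumber beads p =
  let n0 = runnerCount 3 beads 0
      m  = minℕ (runnerCount 3 beads 1) (runnerCount 3 beads 2)
      j  = runnerRank 3 beads p
      k  = p % 3
  in if k ≡ᵇ 0 then suc j
     else if j <ᵇ m then (if k ≡ᵇ 2 then n0 + 2 * j + 1 else n0 + 2 * j + 2)
     else n0 + 2 * m + (j ∸ m) + 1

delta3bar : List ℕ → ℤ
delta3bar λs = numberingSign λs (barNumber λs)

-- Λ_ℓ = (3ℓ-2, ..., 4, 1), and Λ_ℓ + Σ_{i ∈ I} e_i  (an element of F_1^m(Λ_ℓ)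
-- with m = |I|).  Row i (1-indexed, i = toℕ i' + 1) is 3(ℓ - i) + 1.

Lambda : ℕ → List ℕ
Lambda ℓ = toList (tabulate {n = ℓ} (λ i → 3 * (ℓ ∸ suc (toℕ i)) + 1))

addNodes : (ℓ : ℕ) → Subset ℓ → List ℕ
addNodes ℓ I = toList (tabulate (λ i → 3 * (ℓ ∸ suc (toℕ i)) + 1 + (if lookup I i then 1 else 0)))

-- δ₂ and δ̄₃ are both signs of numberings "layer by layer": a bead's layer is its rank on its
-- runner, and within a layer a two-valued class of the runner decides the order (runner 0 before
-- runner 1 for δ₂, runner 2 before runner 1 for δ̄₃). The number of inversions of such a numbering
-- depends only on the word of classes read from the top bead down, and its parity is
-- Σ_{true letters} (letters after it) + (#true ∸ #false) C 2.
--
-- For δ̄₃(μ) the word is I itself. For δ₂(μ^b[1]) one computes the β-numbers of D(μ) with 3ℓ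
-- beads: μ_j + 3ℓ and 3j, 3j + 1 + [j ∈ I] for every row j (counted from the top, from 0).
-- Their runner-1 part consists of ℓ + (ℓ − 1 − j) and j for the rows j ∉ I, so the class word
-- is a word followed by its reversed complement. Adding up, the exponent is congruent mod 2 to
-- (ℓ−m) C 2 + (m ∸ (ℓ−m)) C 2 + mℓ + m + ℓ C 2, whose parity is read off separately for 2m ≤ ℓ
-- and ℓ ≤ 2m.

module Submission where

open import Defs
open import Data.Bool using (Bool; true; false; if_then_else_; _∧_; _∨_; not; T)
open import Data.Bool.Properties using (∧-zeroʳ; ∧-identityʳ; ∨-identityʳ; not-involutive; T-≡)
open import Data.Nat
open import Data.Nat.Properties
open import Data.Nat.DivMod using (_%_; _/_; m%n<n; [m+kn]%n≡m%n; m*n/n≡m; m/n≡1+[m∸n]/n; m*n%n≡0)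
open import Data.Nat.Combinatorics using (_C_; nCk+nC[k+1]≡[n+1]C[k+1]; nC1≡n)
open import Data.Nat.ListAction using (sum)
open import Data.Nat.Tactic.RingSolver using (solve-∀)
open import Data.Parity.Base as ℙ using (0ℙ; 1ℙ)
open import Data.Parity.Properties as ℙₚ using (+-homo-+; *-homo-*)
open import Data.Integer using (ℤ; -1ℤ; 1ℤ)
import Data.Integer as ℤ
import Data.Integer.Properties as ℤₚ
open import Data.Fin.Subset using (Subset; ∣_∣)
open import Data.List using (List; []; _∷_; length; map; filterᵇ; applyUpTo; zip; reverse; _++_; _∷ʳ_)
open import Data.List.Properties
  using (length-++; length-map; length-reverse; length-applyUpTo; map-++; map-applyUpTo; applyUpTo-∷ʳ; ++-assoc;
         ++-identityʳ; unfold-reverse; reverse-++; reverse-map; map-cong; map-cong-local; map-∘; filter-++)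
open import Data.List.Membership.Propositional using (_∈_)
open import Data.List.Relation.Unary.Any using (here; there)
open import Data.List.Relation.Unary.All as All using (All; []; _∷_)
import Data.List.Relation.Unary.All.Properties as Allₚ
open import Data.List.Relation.Unary.AllPairs as AllPairs using (AllPairs; []; _∷_)
import Data.List.Relation.Unary.AllPairs.Properties as AllPairsₚ
open import Data.Product using (_×_; _,_; proj₁; proj₂)
open import Data.Sum using (_⊎_; inj₁; inj₂)
open import Data.Vec using (Vec; []; _∷_; toList)
open import Function using (_∘_; id)
open import Function.Bundles using (Equivalence)
open import Level using (0ℓ)
open import Relation.Binary.Bundles using (Setoid)
open import Relation.Binary.Definitions using (tri<; tri≈; tri>)
open import Relation.Binary.PropositionalEquality
import Relation.Binary.Reasoning.Setoid as SetoidReasoning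
open import Relation.Nullary using (yes; no; contradiction)
open import Relation.Nullary.Decidable using (T?)

bit : Bool → ℕ
bit b = if b then 1 else 0

bit≤1 : ∀ b → bit b ≤ 1
bit≤1 true  = s≤s z≤n
bit≤1 false = z≤n

module _ {A : Set} where

  count-∷ : ∀ (p : A → Bool) x xs → count p (x ∷ xs) ≡ bit (p x) + count p xs
  count-∷ p x xs with p x
  ... | true  = refl
  ... | false = refl

  count-++ : ∀ (p : A → Bool) xs ys → count p (xs ++ ys) ≡ count p xs + count p ys
  count-++ p []       ys = refl
  count-++ p (x ∷ xs) ys = begin
    count p (x ∷ xs ++ ys)               ≡⟨ count-∷ p x (xs ++ ys) ⟩
    bit (p x) + count p (xs ++ ys)       ≡⟨ cong (bit (p x) +_) (count-++ p xs ys) ⟩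
    bit (p x) + (count p xs + count p ys) ≡⟨ +-assoc (bit (p x)) _ _ ⟨
    bit (p x) + count p xs + count p ys  ≡⟨ cong (_+ count p ys) (count-∷ p x xs) ⟨
    count p (x ∷ xs) + count p ys        ∎
    where open ≡-Reasoning

  count-reverse : ∀ (p : A → Bool) xs → count p (reverse xs) ≡ count p xs
  count-reverse p []       = refl
  count-reverse p (x ∷ xs) = begin
    count p (reverse (x ∷ xs))            ≡⟨ cong (count p) (unfold-reverse x xs) ⟩
    count p (reverse xs ++ x ∷ [])        ≡⟨ count-++ p (reverse xs) (x ∷ []) ⟩
    count p (reverse xs) + count p (x ∷ []) ≡⟨ cong₂ _+_ (count-reverse p xs) (count-∷ p x []) ⟩
    count p xs + (bit (p x) + 0)          ≡⟨ cong (count p xs +_) (+-identityʳ (bit (p x))) ⟩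
    count p xs + bit (p x)                ≡⟨ +-comm (count p xs) _ ⟩
    bit (p x) + count p xs                ≡⟨ count-∷ p x xs ⟨
    count p (x ∷ xs)                      ∎
    where open ≡-Reasoning

  count-cong : ∀ (p q : A → Bool) xs → (∀ {x} → x ∈ xs → p x ≡ q x) → count p xs ≡ count q xs
  count-cong p q []       eq = refl
  count-cong p q (x ∷ xs) eq = begin
    count p (x ∷ xs)           ≡⟨ count-∷ p x xs ⟩
    bit (p x) + count p xs     ≡⟨ cong₂ (λ b n → bit b + n) (eq (here refl)) (count-cong p q xs (eq ∘ there)) ⟩
    bit (q x) + count q xs     ≡⟨ count-∷ q x xs ⟨
    count q (x ∷ xs)           ∎
    where open ≡-Reasoning

  count-const-false : ∀ (p : A → Bool) xs → (∀ {x} → x ∈ xs → p x ≡ false) → count p xs ≡ 0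
  count-const-false p xs eq = trans (count-cong p (λ _ → false) xs eq) (zero-count xs)
    where
    zero-count : ∀ xs → count (λ _ → false) xs ≡ 0
    zero-count []       = refl
    zero-count (_ ∷ xs) = zero-count xs

  count+count-not : ∀ (p : A → Bool) xs → count p xs + count (not ∘ p) xs ≡ length xs
  count+count-not p []       = refl
  count+count-not p (x ∷ xs) with p x
  ... | true  = cong suc (count+count-not p xs)
  ... | false = trans (+-suc (count p xs) _) (cong suc (count+count-not p xs))

  count-mono : ∀ (p q : A → Bool) xs → (∀ {x} → x ∈ xs → p x ≡ true → q x ≡ true) →
    count p xs ≤ count q xs
  count-mono p q []       p⇒q = z≤n
  count-mono p q (x ∷ xs) p⇒q with p x in px | q x in qx
  ... | true  | true  = s≤s (count-mono p q xs (p⇒q ∘ there))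
  ... | false | true  = m≤n⇒m≤1+n (count-mono p q xs (p⇒q ∘ there))
  ... | false | false = count-mono p q xs (p⇒q ∘ there)
  ... | true  | false = contradiction (trans (sym qx) (p⇒q (here refl) px)) (λ ())

  count-strict : ∀ (p q : A → Bool) xs → (∀ {x} → x ∈ xs → p x ≡ true → q x ≡ true) →
    ∀ {y} → y ∈ xs → p y ≡ false → q y ≡ true → count p xs < count q xs
  count-strict p q (x ∷ xs) p⇒q (here refl) py qy rewrite count-∷ p x xs | count-∷ q x xs | py | qy =
    s≤s (count-mono p q xs (p⇒q ∘ there))
  count-strict p q (x ∷ xs) p⇒q (there y∈) py qy with p x in px | q x in qx
  ... | true  | true  = s≤s (count-strict p q xs (p⇒q ∘ there) y∈ py qy)
  ... | false | true  = m<n⇒m<1+n (count-strict p q xs (p⇒q ∘ there) y∈ py qy)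
  ... | false | false = count-strict p q xs (p⇒q ∘ there) y∈ py qy
  ... | true  | false = contradiction (trans (sym qx) (p⇒q (here refl) px)) (λ ())

  sum-map-bit : ∀ (p : A → Bool) xs → sum (map (bit ∘ p) xs) ≡ count p xs
  sum-map-bit p []       = refl
  sum-map-bit p (x ∷ xs) = trans (cong (bit (p x) +_) (sum-map-bit p xs)) (sym (count-∷ p x xs))

  sum-map-cong : ∀ (f g : A → ℕ) xs → (∀ {x} → x ∈ xs → f x ≡ g x) → sum (map f xs) ≡ sum (map g xs)
  sum-map-cong f g []       eq = refl
  sum-map-cong f g (x ∷ xs) eq = cong₂ _+_ (eq (here refl)) (sum-map-cong f g xs (eq ∘ there))

  sum-map-+ : ∀ (f g : A → ℕ) xs → sum (map (λ x → f x + g x) xs) ≡ sum (map f xs) + sum (map g xs)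
  sum-map-+ f g []       = refl
  sum-map-+ f g (x ∷ xs) = begin
    f x + g x + sum (map (λ x → f x + g x) xs)         ≡⟨ cong (f x + g x +_) (sum-map-+ f g xs) ⟩
    f x + g x + (sum (map f xs) + sum (map g xs))      ≡⟨ shuffle (f x) (g x) _ _ ⟩
    f x + sum (map f xs) + (g x + sum (map g xs))      ∎
    where
    open ≡-Reasoning
    shuffle : ∀ a b c d → a + b + (c + d) ≡ a + c + (b + d)
    shuffle = solve-∀

count-map : ∀ {A B : Set} (p : B → Bool) (f : A → B) xs → count p (map f xs) ≡ count (p ∘ f) xs
count-map p f []       = refl
count-map p f (x ∷ xs) =
  trans (count-∷ p (f x) (map f xs)) (trans (cong (bit (p (f x)) +_) (count-map p f xs)) (sym (count-∷ (p ∘ f) x xs)))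

<ᵇ-true : ∀ {m n} → m < n → (m <ᵇ n) ≡ true
<ᵇ-true m<n = Equivalence.to T-≡ (<⇒<ᵇ m<n)

<ᵇ-false : ∀ {m n} → n ≤ m → (m <ᵇ n) ≡ false
<ᵇ-false {m} {n} n≤m with m <ᵇ n in eq
... | false = refl
... | true  = contradiction (<ᵇ⇒< m n (Equivalence.from T-≡ eq)) (≤⇒≯ n≤m)

≤ᵇ-true : ∀ {m n} → m ≤ n → (m ≤ᵇ n) ≡ true
≤ᵇ-true m≤n = Equivalence.to T-≡ (≤⇒≤ᵇ m≤n)

≤ᵇ-false : ∀ {m n} → n < m → (m ≤ᵇ n) ≡ false
≤ᵇ-false {m} {n} n<m with m ≤ᵇ n in eq
... | false = refl
... | true  = contradiction (≤ᵇ⇒≤ m n (Equivalence.from T-≡ eq)) (<⇒≱ n<m)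

n<ᵇn : ∀ n → (n <ᵇ n) ≡ false
n<ᵇn n = <ᵇ-false {n} ≤-refl

<ᵇ-suc : ∀ m n → (m <ᵇ suc n) ≡ (m ≤ᵇ n)
<ᵇ-suc zero    n = refl
<ᵇ-suc (suc m) n = refl

<ᵇ-true⇒< : ∀ m n → (m <ᵇ n) ≡ true → m < n
<ᵇ-true⇒< m n eq = <ᵇ⇒< m n (Equivalence.from T-≡ eq)

<ᵇ-false⇒≥ : ∀ m n → (m <ᵇ n) ≡ false → n ≤ m
<ᵇ-false⇒≥ m n eq = ≮⇒≥ (λ m<n → subst T eq (<⇒<ᵇ m<n))

sgn-+ : ∀ a b → sgn (a + b) ≡ sgn a ℤ.* sgn b
sgn-+ = ℤₚ.^-distribˡ-+-* -1ℤ

-- A record rather than a synonym for parity a ≡ parity b, so that a and b can be inferred.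
infix 4 _≡₂_

record _≡₂_ (a b : ℕ) : Set where
  constructor mk≡₂
  field parity≡ : parity a ≡ parity b

≡₂-setoid : Setoid 0ℓ 0ℓ
≡₂-setoid = record
  { Carrier       = ℕ
  ; _≈_           = _≡₂_
  ; isEquivalence = record
    { refl  = mk≡₂ refl
    ; sym   = λ (mk≡₂ p) → mk≡₂ (sym p)
    ; trans = λ (mk≡₂ p) (mk≡₂ q) → mk≡₂ (trans p q)
    }
  }

module ≡₂ = Setoid ≡₂-setoid
module ≡₂-Reasoning = SetoidReasoning ≡₂-setoid

sgn-≡₂ : ∀ {a b} → a ≡₂ b → sgn a ≡ sgn b
sgn-≡₂ {a} {b} (mk≡₂ eq) = trans (sgn≡ a) (trans (cong toℤ eq) (sym (sgn≡ b)))
  where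
  toℤ : ℙ.Parity → ℤ
  toℤ 0ℙ = 1ℤ
  toℤ 1ℙ = -1ℤ
  sgn≡ : ∀ n → sgn n ≡ toℤ (parity n)
  sgn≡ zero          = refl
  sgn≡ (suc zero)    = refl
  sgn≡ (suc (suc n)) = trans (sym (ℤₚ.*-assoc -1ℤ -1ℤ (sgn n))) (trans (ℤₚ.*-identityˡ (sgn n)) (sgn≡ n))

+-≡₂ : ∀ {a b c d} → a ≡₂ b → c ≡₂ d → a + c ≡₂ b + d
+-≡₂ {a} {b} {c} {d} (mk≡₂ a≡b) (mk≡₂ c≡d) =
  mk≡₂ (trans (+-homo-+ a c) (trans (cong₂ ℙ._+_ a≡b c≡d) (sym (+-homo-+ b d))))

+-double-≡₂ : ∀ a k → a + 2 * k ≡₂ a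
+-double-≡₂ a k =
  mk≡₂ (trans (+-homo-+ a (2 * k)) (trans (cong (parity a ℙ.+_) (*-homo-* 2 k)) (ℙₚ.+-identityʳ (parity a))))

square-≡₂ : ∀ n → n * n ≡₂ n
square-≡₂ n = mk≡₂ (trans (*-homo-* n n) (idem (parity n)))
  where
  idem : ∀ p → p ℙ.* p ≡ p
  idem 0ℙ = refl
  idem 1ℙ = refl

C2-suc : ∀ n → suc n C 2 ≡ n + n C 2
C2-suc n = trans (sym (nCk+nC[k+1]≡[n+1]C[k+1] n 1)) (cong (_+ n C 2) (nC1≡n n))

C2-+ : ∀ a b → (a + b) C 2 ≡ a C 2 + b C 2 + a * b
C2-+ zero    b = sym (+-identityʳ (b C 2))
C2-+ (suc a) b = begin
  suc (a + b) C 2                          ≡⟨ C2-suc (a + b) ⟩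
  a + b + (a + b) C 2                      ≡⟨ cong (a + b +_) (C2-+ a b) ⟩
  a + b + (a C 2 + b C 2 + a * b)          ≡⟨ rearrange a b (a C 2) (b C 2) ⟩
  a + a C 2 + b C 2 + suc a * b            ≡⟨ cong (λ x → x + b C 2 + suc a * b) (C2-suc a) ⟨
  suc a C 2 + b C 2 + suc a * b            ∎
  where
  open ≡-Reasoning
  rearrange : ∀ a b x y → a + b + (x + y + a * b) ≡ a + x + y + suc a * b
  rearrange = solve-∀

-- Numberings by layers

Decreasing : List ℕ → Set
Decreasing = AllPairs _>_

_==_ : Bool → Bool → Bool
a == b = if b then a else not a

==-refl : ∀ a → (a == a) ≡ true
==-refl true  = refl
==-refl false = refl

==⇒≡ : ∀ {a b} → (a == b) ≡ true → a ≡ b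
==⇒≡ {true}  {true}  _ = refl
==⇒≡ {false} {false} _ = refl

before : Bool → ℕ → Bool → ℕ → Bool
before a j b k = if a ∧ not b then j ≤ᵇ k else j <ᵇ k

-- The word lists the classes of the beads from the highest position down; the term of the top
-- bead counts the beads below it that a numbering by layers (class true first) puts after it.
layeredInversions : List Bool → ℕ
layeredInversions []      = 0
layeredInversions (a ∷ w) = layeredInversions w +
  (if a then count not w ∸ count id w else count id w ∸ suc (count not w))

inversions-∷ : ∀ {x xs} num → All (_< x) xs →
  inversions (x ∷ xs) num ≡ inversions xs num + count (λ b → num x <ᵇ num b) xs
inversions-∷ {x} {xs} num below = begin
  inversions (x ∷ xs) num
    ≡⟨ cong₂ _+_ head-term (sum-map-cong _ _ xs tail-term) ⟩
  0 + sum (map (λ b → bit (num x <ᵇ num b) + after b xs) xs)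
    ≡⟨ sum-map-+ (λ b → bit (num x <ᵇ num b)) (λ b → after b xs) xs ⟩
  sum (map (λ b → bit (num x <ᵇ num b)) xs) + inversions xs num
    ≡⟨ cong (_+ inversions xs num) (sum-map-bit (λ b → num x <ᵇ num b) xs) ⟩
  count (λ b → num x <ᵇ num b) xs + inversions xs num
    ≡⟨ +-comm _ (inversions xs num) ⟩
  inversions xs num + count (λ b → num x <ᵇ num b) xs
    ∎
  where
  open ≡-Reasoning
  after : ℕ → List ℕ → ℕ
  after b = count (λ c → (b <ᵇ c) ∧ (num c <ᵇ num b))
  head-term : after x (x ∷ xs) ≡ 0
  head-term = count-const-false _ (x ∷ xs) not-above
    where
    not-above : ∀ {c} → c ∈ x ∷ xs → ((x <ᵇ c) ∧ (num c <ᵇ num x)) ≡ false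
    not-above (here refl)    = cong (_∧ (num x <ᵇ num x)) (n<ᵇn x)
    not-above {c} (there c∈) = cong (_∧ (num c <ᵇ num x)) (<ᵇ-false (<⇒≤ (All.lookup below c∈)))
  tail-term : ∀ {b} → b ∈ xs → after b (x ∷ xs) ≡ bit (num x <ᵇ num b) + after b xs
  tail-term {b} b∈ = trans (count-∷ _ x xs)
    (cong (λ t → bit (t ∧ (num x <ᵇ num b)) + after b xs) (<ᵇ-true (All.lookup below b∈)))

module Layered (runner : ℕ → ℕ) (class : ℕ → Bool) where

  rank : List ℕ → ℕ → ℕ
  rank L p = count (λ q → (runner q ≡ᵇ runner p) ∧ (q <ᵇ p)) L

  classSize : Bool → List ℕ → ℕ
  classSize c = count (λ q → class q == c)

  RunnersAreClasses : List ℕ → Set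
  RunnersAreClasses L = ∀ {q p} → q ∈ L → p ∈ L → (runner q ≡ᵇ runner p) ≡ (class q == class p)

  NumbersByLayers : List ℕ → (ℕ → ℕ) → Set
  NumbersByLayers L num = ∀ {c b} → c ∈ L → b ∈ L →
    (num c <ᵇ num b) ≡ before (class c) (rank L c) (class b) (rank L b)

  RunnersAreClasses-tail : ∀ {x xs} → RunnersAreClasses (x ∷ xs) → RunnersAreClasses xs
  RunnersAreClasses-tail sep q∈ p∈ = sep (there q∈) (there p∈)

  classSize-∷ : ∀ c y ys → classSize c (y ∷ ys) ≡ bit (class y == c) + classSize c ys
  classSize-∷ c = count-∷ (λ q → class q == c)

  module _ {x : ℕ} {xs : List ℕ} (below : All (_< x) xs) where

    rank-∷ : ∀ {b} → b ∈ xs → rank (x ∷ xs) b ≡ rank xs b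
    rank-∷ {b} b∈xs = begin
      rank (x ∷ xs) b
        ≡⟨ count-∷ _ x xs ⟩
      bit ((runner x ≡ᵇ runner b) ∧ (x <ᵇ b)) + rank xs b
        ≡⟨ cong (λ t → bit ((runner x ≡ᵇ runner b) ∧ t) + rank xs b) (<ᵇ-false (<⇒≤ (All.lookup below b∈xs))) ⟩
      bit ((runner x ≡ᵇ runner b) ∧ false) + rank xs b
        ≡⟨ cong (λ t → bit t + rank xs b) (∧-zeroʳ _) ⟩
      rank xs b
        ∎
      where open ≡-Reasoning

    rank-head : RunnersAreClasses (x ∷ xs) → rank (x ∷ xs) x ≡ classSize (class x) xs
    rank-head sep = begin
      rank (x ∷ xs) x
        ≡⟨ count-∷ _ x xs ⟩
      bit ((runner x ≡ᵇ runner x) ∧ (x <ᵇ x)) + rank xs x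
        ≡⟨ cong (λ t → bit ((runner x ≡ᵇ runner x) ∧ t) + rank xs x) (n<ᵇn x) ⟩
      bit ((runner x ≡ᵇ runner x) ∧ false) + rank xs x
        ≡⟨ cong (λ t → bit t + rank xs x) (∧-zeroʳ _) ⟩
      rank xs x
        ≡⟨ count-cong _ _ xs same-class ⟩
      classSize (class x) xs
        ∎
      where
      open ≡-Reasoning
      same-class : ∀ {q} → q ∈ xs → ((runner q ≡ᵇ runner x) ∧ (q <ᵇ x)) ≡ (class q == class x)
      same-class {q} q∈xs = begin
        (runner q ≡ᵇ runner x) ∧ (q <ᵇ x)  ≡⟨ cong ((runner q ≡ᵇ runner x) ∧_) (<ᵇ-true (All.lookup below q∈xs)) ⟩
        (runner q ≡ᵇ runner x) ∧ true     ≡⟨ ∧-identityʳ _ ⟩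
        runner q ≡ᵇ runner x              ≡⟨ sep (there q∈xs) (here refl) ⟩
        class q == class x                ∎

  rank<classSize : ∀ {L} → Decreasing L → RunnersAreClasses L →
    ∀ {b} → b ∈ L → rank L b < classSize (class b) L
  rank<classSize {y ∷ ys} (below ∷ dec) sep (here refl) = begin-strict
    rank (y ∷ ys) y                                    ≡⟨ rank-head below sep ⟩
    classSize (class y) ys                             <⟨ n<1+n _ ⟩
    suc (classSize (class y) ys)                       ≡⟨ cong (λ t → bit t + classSize (class y) ys) (==-refl (class y)) ⟨
    bit (class y == class y) + classSize (class y) ys  ≡⟨ classSize-∷ (class y) y ys ⟨
    classSize (class y) (y ∷ ys)                       ∎
    where open ≤-Reasoning
  rank<classSize {y ∷ ys} (below ∷ dec) sep {b} (there b∈ys) = begin-strict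
    rank (y ∷ ys) b                                    ≡⟨ rank-∷ below b∈ys ⟩
    rank ys b                                          <⟨ rank<classSize dec (RunnersAreClasses-tail sep) b∈ys ⟩
    classSize (class b) ys                             ≤⟨ m≤n+m _ _ ⟩
    bit (class y == class b) + classSize (class b) ys  ≡⟨ classSize-∷ (class b) y ys ⟨
    classSize (class b) (y ∷ ys)                       ∎
    where open ≤-Reasoning

  count-rank≥ : ∀ {L} → Decreasing L → RunnersAreClasses L → ∀ c t →
    count (λ b → (class b == c) ∧ (t ≤ᵇ rank L b)) L ≡ classSize c L ∸ t
  count-rank≥ {[]}     []            sep c t = sym (0∸n≡0 t)
  count-rank≥ {y ∷ ys} (below ∷ dec) sep c t = begin
    count P (y ∷ ys)
      ≡⟨ count-∷ P y ys ⟩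
    bit (P y) + count P ys
      ≡⟨ cong₂ (λ r n → bit ((class y == c) ∧ (t ≤ᵇ r)) + n) (rank-head below sep) (count-cong P P′ ys tail-ranks) ⟩
    bit ((class y == c) ∧ (t ≤ᵇ classSize (class y) ys)) + count P′ ys
      ≡⟨ cong (bit ((class y == c) ∧ (t ≤ᵇ classSize (class y) ys)) +_) (count-rank≥ dec (RunnersAreClasses-tail sep) c t) ⟩
    bit ((class y == c) ∧ (t ≤ᵇ classSize (class y) ys)) + (classSize c ys ∸ t)
      ≡⟨ head-step (class y) (class y == c) refl ⟩
    bit (class y == c) + classSize c ys ∸ t
      ≡⟨ cong (_∸ t) (classSize-∷ c y ys) ⟨
    classSize c (y ∷ ys) ∸ t
      ∎
    where
    open ≡-Reasoning
    P P′ : ℕ → Bool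
    P  b = (class b == c) ∧ (t ≤ᵇ rank (y ∷ ys) b)
    P′ b = (class b == c) ∧ (t ≤ᵇ rank ys b)
    tail-ranks : ∀ {b} → b ∈ ys → P b ≡ P′ b
    tail-ranks b∈ys = cong (λ r → (class _ == c) ∧ (t ≤ᵇ r)) (rank-∷ below b∈ys)
    bit-≤ᵇ+∸ : ∀ s → bit (t ≤ᵇ s) + (s ∸ t) ≡ suc s ∸ t
    bit-≤ᵇ+∸ s with t ≤? s
    ... | yes t≤s rewrite ≤ᵇ-true t≤s = sym (+-∸-assoc 1 t≤s)
    ... | no  t≰s rewrite ≤ᵇ-false (≰⇒> t≰s) | m≤n⇒m∸n≡0 (<⇒≤ (≰⇒> t≰s)) =
      sym (m≤n⇒m∸n≡0 (≰⇒> t≰s))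
    head-step : ∀ d e → (d == c) ≡ e →
      bit (e ∧ (t ≤ᵇ classSize d ys)) + (classSize c ys ∸ t) ≡ bit e + classSize c ys ∸ t
    head-step d true  eq = subst (λ d → bit (t ≤ᵇ classSize d ys) + (classSize c ys ∸ t) ≡ suc (classSize c ys) ∸ t)
                                 (sym (==⇒≡ eq)) (bit-≤ᵇ+∸ (classSize c ys))
    head-step d false _  = refl

  count-after-top : ∀ {xs} → Decreasing xs → RunnersAreClasses xs → ∀ a →
    count (λ b → before a (classSize a xs) (class b) (rank xs b)) xs
      ≡ (if a then classSize false xs ∸ classSize true xs else classSize true xs ∸ suc (classSize false xs))
  count-after-top {xs} dec sep true =
    trans (count-cong _ _ xs after-true) (count-rank≥ dec sep false (classSize true xs))
    where
    after-true : ∀ {b} → b ∈ xs → before true (classSize true xs) (class b) (rank xs b)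
                                 ≡ ((class b == false) ∧ (classSize true xs ≤ᵇ rank xs b))
    after-true {b} b∈ with class b in cb
    ... | true  = <ᵇ-false (<⇒≤ (subst (λ c → rank xs b < classSize c xs) cb (rank<classSize dec sep b∈)))
    ... | false = refl
  count-after-top {xs} dec sep false =
    trans (count-cong _ _ xs after-false) (count-rank≥ dec sep true (suc (classSize false xs)))
    where
    after-false : ∀ {b} → b ∈ xs → before false (classSize false xs) (class b) (rank xs b)
                                  ≡ ((class b == true) ∧ (suc (classSize false xs) ≤ᵇ rank xs b))
    after-false {b} b∈ with class b in cb
    ... | true  = refl
    ... | false = <ᵇ-false (<⇒≤ (subst (λ c → rank xs b < classSize c xs) cb (rank<classSize dec sep b∈)))

  inversions-byLayers : ∀ {L} num → Decreasing L → RunnersAreClasses L → NumbersByLayers L num →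
    inversions L num ≡ layeredInversions (map class L)
  inversions-byLayers {[]}     num dec           sep byLayers = refl
  inversions-byLayers {x ∷ xs} num (below ∷ dec) sep byLayers = begin
    inversions (x ∷ xs) num
      ≡⟨ inversions-∷ num below ⟩
    inversions xs num + count (λ b → num x <ᵇ num b) xs
      ≡⟨ cong₂ _+_ (inversions-byLayers num dec sep′ byLayers′) (count-cong _ _ xs byRank) ⟩
    layeredInversions (map class xs) + count (λ b → before (class x) (classSize (class x) xs) (class b) (rank xs b)) xs
      ≡⟨ cong (layeredInversions (map class xs) +_) (count-after-top dec sep′ (class x)) ⟩
    layeredInversions (map class xs)
      + (if class x then classSize false xs ∸ classSize true xs else classSize true xs ∸ suc (classSize false xs))
      ≡⟨ cong₂ (λ f t → layeredInversions (map class xs) + (if class x then f ∸ t else t ∸ suc f))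
               (count-map not class xs) (count-map id class xs) ⟨
    layeredInversions (map class (x ∷ xs))
      ∎
    where
    open ≡-Reasoning
    sep′ = RunnersAreClasses-tail sep
    byLayers′ : NumbersByLayers xs num
    byLayers′ c∈ b∈ = trans (byLayers (there c∈) (there b∈))
                            (cong₂ (λ j k → before (class _) j (class _) k) (rank-∷ below c∈) (rank-∷ below b∈))
    byRank : ∀ {b} → b ∈ xs → (num x <ᵇ num b) ≡ before (class x) (classSize (class x) xs) (class b) (rank xs b)
    byRank {b} b∈ = trans (byLayers (here refl) (there b∈))
                          (cong₂ (λ j k → before (class x) j (class b) k) (rank-head below sep) (rank-∷ below b∈))

-- δ₂ and the layer numbering

countBelow-< : ∀ (κ : ℕ → ℕ) L {c b} → c ∈ L → κ c < κ b →
  count (λ q → κ q <ᵇ κ c) L < count (λ q → κ q <ᵇ κ b) L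
countBelow-< κ L {c} c∈ c<b =
  count-strict _ _ L (λ _ q<c → <ᵇ-true (<-trans (<ᵇ-true⇒< _ _ q<c) c<b)) c∈ (n<ᵇn (κ c)) (<ᵇ-true c<b)

countBelow-<ᵇ : ∀ (κ : ℕ → ℕ) L {c b} → c ∈ L → b ∈ L →
  (count (λ q → κ q <ᵇ κ c) L <ᵇ count (λ q → κ q <ᵇ κ b) L) ≡ (κ c <ᵇ κ b)
countBelow-<ᵇ κ L {c} {b} c∈ b∈ with <-cmp (κ c) (κ b)
... | tri< c<b _ _ = trans (<ᵇ-true (countBelow-< κ L c∈ c<b)) (sym (<ᵇ-true c<b))
... | tri≈ _ c≡b _ rewrite c≡b = trans (n<ᵇn (count (λ q → κ q <ᵇ κ b) L)) (sym (n<ᵇn (κ b)))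
... | tri> _ _ b<c = trans (<ᵇ-false (<⇒≤ (countBelow-< κ L b∈ b<c))) (sym (<ᵇ-false (<⇒≤ b<c)))

lex-<ᵇ : ∀ j k {r s} → r < 2 → s < 2 → (2 * j + r <ᵇ 2 * k + s) ≡ ((j <ᵇ k) ∨ ((j ≡ᵇ k) ∧ (r <ᵇ s)))
lex-<ᵇ zero    zero            r<2 s<2 = refl
lex-<ᵇ zero    (suc k) {r} {s} r<2 s<2 =
  <ᵇ-true (<-≤-trans r<2 (≤-trans (*-monoʳ-≤ 2 (s≤s z≤n)) (m≤m+n (2 * suc k) s)))
lex-<ᵇ (suc j) zero    {r} {s} r<2 s<2 =
  <ᵇ-false (≤-trans (<⇒≤ s<2) (≤-trans (*-monoʳ-≤ 2 (s≤s z≤n)) (m≤m+n (2 * suc j) r)))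
lex-<ᵇ (suc j) (suc k) {r} {s} r<2 s<2 = trans (cong₂ _<ᵇ_ (shift j r) (shift k s)) (lex-<ᵇ j k r<2 s<2)
  where
  shift : ∀ j r → 2 * suc j + r ≡ 2 + (2 * j + r)
  shift = solve-∀

layerKey : ℕ → Bool → ℕ
layerKey j a = 2 * j + bit (not a)

bit<2 : ∀ b → bit b < 2
bit<2 true  = s≤s (s≤s z≤n)
bit<2 false = s≤s z≤n

<ᵇ∨≡ᵇ : ∀ j k → ((j <ᵇ k) ∨ (j ≡ᵇ k)) ≡ (j ≤ᵇ k)
<ᵇ∨≡ᵇ zero    zero    = refl
<ᵇ∨≡ᵇ zero    (suc k) = refl
<ᵇ∨≡ᵇ (suc j) zero    = refl
<ᵇ∨≡ᵇ (suc j) (suc k) = trans (<ᵇ∨≡ᵇ j k) (sym (<ᵇ-suc j k))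

before-layerKey : ∀ a j b k → before a j b k ≡ (layerKey j a <ᵇ layerKey k b)
before-layerKey a j b k = trans (lexicographic a b) (sym (lex-<ᵇ j k (bit<2 (not a)) (bit<2 (not b))))
  where
  strict : (j <ᵇ k) ≡ ((j <ᵇ k) ∨ ((j ≡ᵇ k) ∧ false))
  strict = sym (trans (cong ((j <ᵇ k) ∨_) (∧-zeroʳ (j ≡ᵇ k))) (∨-identityʳ (j <ᵇ k)))
  lexicographic : ∀ a b → before a j b k ≡ ((j <ᵇ k) ∨ ((j ≡ᵇ k) ∧ (bit (not a) <ᵇ bit (not b))))
  lexicographic true  true  = strict
  lexicographic true  false = sym (trans (cong ((j <ᵇ k) ∨_) (∧-identityʳ (j ≡ᵇ k))) (<ᵇ∨≡ᵇ j k))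
  lexicographic false true  = strict
  lexicographic false false = strict

onRunner0 : ℕ → Bool
onRunner0 q = q % 2 ≡ᵇ 0

module L₂ = Layered (_% 2) onRunner0

mod2≡bit : ∀ q → q % 2 ≡ bit (not (onRunner0 q))
mod2≡bit q with q % 2 | m%n<n q 2
... | 0           | _               = refl
... | 1           | _               = refl
... | suc (suc _) | s≤s (s≤s ())

runnersAreClasses₂ : ∀ L → L₂.RunnersAreClasses L
runnersAreClasses₂ L {q} {p} _ _ rewrite mod2≡bit q | mod2≡bit p with onRunner0 q | onRunner0 p
... | true  | true  = refl
... | true  | false = refl
... | false | true  = refl
... | false | false = refl

layerKeyLess≡ : ∀ L q p →
  layerKeyLess L q p ≡ (layerKey (L₂.rank L q) (onRunner0 q) <ᵇ layerKey (L₂.rank L p) (onRunner0 p))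
layerKeyLess≡ L q p = begin
  layerKeyLess L q p
    ≡⟨ lex-<ᵇ (L₂.rank L q) (L₂.rank L p) (m%n<n q 2) (m%n<n p 2) ⟨
  2 * L₂.rank L q + q % 2 <ᵇ 2 * L₂.rank L p + p % 2
    ≡⟨ cong₂ (λ r s → 2 * L₂.rank L q + r <ᵇ 2 * L₂.rank L p + s) (mod2≡bit q) (mod2≡bit p) ⟩
  layerKey (L₂.rank L q) (onRunner0 q) <ᵇ layerKey (L₂.rank L p) (onRunner0 p)
    ∎
  where open ≡-Reasoning

layerNumber-byLayers : ∀ L → L₂.NumbersByLayers L (layerNumber L)
layerNumber-byLayers L {c} {b} c∈ b∈ = begin
  count (λ q → layerKeyLess L q c) L <ᵇ count (λ q → layerKeyLess L q b) L
    ≡⟨ cong₂ _<ᵇ_ (count-cong _ _ L (λ {q} _ → layerKeyLess≡ L q c)) (count-cong _ _ L (λ {q} _ → layerKeyLess≡ L q b)) ⟩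
  count (λ q → κ q <ᵇ κ c) L <ᵇ count (λ q → κ q <ᵇ κ b) L
    ≡⟨ countBelow-<ᵇ κ L c∈ b∈ ⟩
  κ c <ᵇ κ b
    ≡⟨ before-layerKey (onRunner0 c) (L₂.rank L c) (onRunner0 b) (L₂.rank L b) ⟨
  before (onRunner0 c) (L₂.rank L c) (onRunner0 b) (L₂.rank L b)
    ∎
  where
  open ≡-Reasoning
  κ : ℕ → ℕ
  κ q = layerKey (L₂.rank L q) (onRunner0 q)

layerSign : ∀ L → Decreasing L → numberingSign L (layerNumber L) ≡ sgn (layeredInversions (map onRunner0 L))
layerSign L dec = cong sgn (L₂.inversions-byLayers (layerNumber L) dec (runnersAreClasses₂ L) (layerNumber-byLayers L))

-- δ̄₃ and the 3-bar numbering

onRunner2 : ℕ → Bool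
onRunner2 q = q % 3 ≡ᵇ 2

module L₃ = Layered (_% 3) onRunner2

OffRunner0 : List ℕ → Set
OffRunner0 = All (λ x → x % 3 ≡ 1 ⊎ x % 3 ≡ 2)

runnersAreClasses₃ : ∀ {L} → OffRunner0 L → L₃.RunnersAreClasses L
runnersAreClasses₃ off {q} {p} q∈ p∈ with All.lookup off q∈ | All.lookup off p∈
... | inj₁ q1 | inj₁ p1 rewrite q1 | p1 = refl
... | inj₁ q1 | inj₂ p2 rewrite q1 | p2 = refl
... | inj₂ q2 | inj₁ p1 rewrite q2 | p1 = refl
... | inj₂ q2 | inj₂ p2 rewrite q2 | p2 = refl

classSize-false₃ : ∀ {L} → OffRunner0 L → L₃.classSize false L ≡ runnerCount 3 L 1
classSize-false₃ {L} off = count-cong _ _ L not-on-2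
  where
  not-on-2 : ∀ {q} → q ∈ L → not (onRunner2 q) ≡ (q % 3 ≡ᵇ 1)
  not-on-2 q∈ with All.lookup off q∈
  ... | inj₁ q1 rewrite q1 = refl
  ... | inj₂ q2 rewrite q2 = refl

-- Runners 1 and 2 alternate, runner 2 first, up to the length m of the shorter one; the rest of
-- the longer one follows.
pairedKey : ℕ → Bool → ℕ → ℕ
pairedKey m a j = if j <ᵇ m then layerKey j a else 2 * m + (j ∸ m)

private
  barNumber-shift : ∀ n₀ m j c lt → (if lt then n₀ + 2 * j + suc c else n₀ + 2 * m + (j ∸ m) + 1)
                                    ≡ n₀ + suc (if lt then 2 * j + c else 2 * m + (j ∸ m))
  barNumber-shift n₀ m j c true  = shift n₀ (2 * j) c
    where
    shift : ∀ a b c → a + b + suc c ≡ a + suc (b + c)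
    shift = solve-∀
  barNumber-shift n₀ m j c false = shift n₀ (2 * m) (j ∸ m)
    where
    shift : ∀ a b c → a + b + c + 1 ≡ a + suc (b + c)
    shift = solve-∀

barNumber-paired : ∀ L p → p % 3 ≡ 1 ⊎ p % 3 ≡ 2 →
  barNumber L p ≡ runnerCount 3 L 0 + suc (pairedKey (minℕ (runnerCount 3 L 1) (runnerCount 3 L 2)) (onRunner2 p) (L₃.rank L p))
barNumber-paired L p (inj₁ e) with p % 3 | e
... | .1 | refl = barNumber-shift (runnerCount 3 L 0) (minℕ (runnerCount 3 L 1) (runnerCount 3 L 2)) _ 1 _
barNumber-paired L p (inj₂ e) with p % 3 | e
... | .2 | refl = barNumber-shift (runnerCount 3 L 0) (minℕ (runnerCount 3 L 1) (runnerCount 3 L 2)) _ 0 _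

+-<ᵇ : ∀ c a b → (c + a <ᵇ c + b) ≡ (a <ᵇ b)
+-<ᵇ zero    a b = refl
+-<ᵇ (suc c) a b = +-<ᵇ c a b

private
  before-< : ∀ a b {j k} → j < k → before a j b k ≡ true
  before-< a b j<k with a ∧ not b
  ... | true  = ≤ᵇ-true (<⇒≤ j<k)
  ... | false = <ᵇ-true j<k

  before-> : ∀ a b {j k} → k < j → before a j b k ≡ false
  before-> a b k<j with a ∧ not b
  ... | true  = ≤ᵇ-false k<j
  ... | false = <ᵇ-false (<⇒≤ k<j)

  before-same : ∀ a j k → before a j a k ≡ (j <ᵇ k)
  before-same true  j k = refl
  before-same false j k = refl

  layerKey<2m : ∀ {j m} a → j < m → layerKey j a < 2 * m
  layerKey<2m {j} {m} a j<m = begin-strict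
    2 * j + bit (not a)  <⟨ +-monoʳ-< (2 * j) (bit<2 (not a)) ⟩
    2 * j + 2            ≡⟨ trans (+-comm (2 * j) 2) (sym (*-suc 2 j)) ⟩
    2 * suc j            ≤⟨ *-monoʳ-≤ 2 j<m ⟩
    2 * m                ∎
    where open ≤-Reasoning

-- Beyond the length of the shorter runner only one class is left, whence the hypothesis.
pairedKey-before : ∀ m a b j k → a ≡ b ⊎ j < m ⊎ k < m → (pairedKey m a j <ᵇ pairedKey m b k) ≡ before a j b k
pairedKey-before m a b j k hyp with j <ᵇ m in ej | k <ᵇ m in ek
... | true  | true  = sym (before-layerKey a j b k)
... | true  | false = trans (<ᵇ-true (<-≤-trans (layerKey<2m a (<ᵇ-true⇒< j m ej)) (m≤m+n (2 * m) (k ∸ m))))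
                           (sym (before-< a b (<-≤-trans (<ᵇ-true⇒< j m ej) (<ᵇ-false⇒≥ k m ek))))
... | false | true  = trans (<ᵇ-false (≤-trans (<⇒≤ (layerKey<2m b (<ᵇ-true⇒< k m ek))) (m≤m+n (2 * m) (j ∸ m))))
                           (sym (before-> a b (<-≤-trans (<ᵇ-true⇒< k m ek) (<ᵇ-false⇒≥ j m ej))))
... | false | false with hyp
...   | inj₁ refl = begin
  2 * m + (j ∸ m) <ᵇ 2 * m + (k ∸ m)
    ≡⟨ +-<ᵇ (2 * m) (j ∸ m) (k ∸ m) ⟩
  j ∸ m <ᵇ k ∸ m
    ≡⟨ +-<ᵇ m (j ∸ m) (k ∸ m) ⟨
  m + (j ∸ m) <ᵇ m + (k ∸ m)
    ≡⟨ cong₂ _<ᵇ_ (m+[n∸m]≡n (<ᵇ-false⇒≥ j m ej)) (m+[n∸m]≡n (<ᵇ-false⇒≥ k m ek)) ⟩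
  j <ᵇ k
    ≡⟨ before-same a j k ⟨
  before a j a k
    ∎
  where open ≡-Reasoning
...   | inj₂ (inj₁ j<m) = contradiction j<m (≤⇒≯ (<ᵇ-false⇒≥ j m ej))
...   | inj₂ (inj₂ k<m) = contradiction k<m (≤⇒≯ (<ᵇ-false⇒≥ k m ek))

private
  <minℕ : ∀ {j k x y} → j < y → k < x → j < minℕ x y ⊎ k < minℕ x y
  <minℕ {x = x} {y} j<y k<x with x ≤ᵇ y
  ... | true  = inj₂ k<x
  ... | false = inj₁ j<y

barNumber-byLayers : ∀ {L} → Decreasing L → OffRunner0 L → L₃.NumbersByLayers L (barNumber L)
barNumber-byLayers {L} dec off {c} {b} c∈ b∈ = begin
  barNumber L c <ᵇ barNumber L b
    ≡⟨ cong₂ _<ᵇ_ (barNumber-paired L c (All.lookup off c∈)) (barNumber-paired L b (All.lookup off b∈)) ⟩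
  n₀ + suc (key c) <ᵇ n₀ + suc (key b)
    ≡⟨ +-<ᵇ n₀ (suc (key c)) (suc (key b)) ⟩
  key c <ᵇ key b
    ≡⟨ pairedKey-before m _ _ _ _ (shortRunner (onRunner2 c) (onRunner2 b) refl refl) ⟩
  before (onRunner2 c) (L₃.rank L c) (onRunner2 b) (L₃.rank L b)
    ∎
  where
  open ≡-Reasoning
  n₀ = runnerCount 3 L 0
  m  = minℕ (runnerCount 3 L 1) (runnerCount 3 L 2)
  key : ℕ → ℕ
  key q = pairedKey m (onRunner2 q) (L₃.rank L q)
  rank< : ∀ {q} → q ∈ L → ∀ a → onRunner2 q ≡ a → L₃.rank L q < L₃.classSize a L
  rank< q∈ a refl = L₃.rank<classSize dec (runnersAreClasses₃ off) q∈
  rank<₁ : ∀ {q} → q ∈ L → onRunner2 q ≡ false → L₃.rank L q < runnerCount 3 L 1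
  rank<₁ {q} q∈ on1 = subst (L₃.rank L q <_) (classSize-false₃ off) (rank< q∈ false on1)
  shortRunner : ∀ a a′ → onRunner2 c ≡ a → onRunner2 b ≡ a′ → a ≡ a′ ⊎ L₃.rank L c < m ⊎ L₃.rank L b < m
  shortRunner true  true  _  _  = inj₁ refl
  shortRunner false false _  _  = inj₁ refl
  shortRunner true  false ec eb = inj₂ (<minℕ (rank< c∈ true ec) (rank<₁ b∈ eb))
  shortRunner false true  ec eb with <minℕ (rank< b∈ true eb) (rank<₁ c∈ ec)
  ... | inj₁ b<m = inj₂ (inj₂ b<m)
  ... | inj₂ c<m = inj₂ (inj₁ c<m)

barSign : ∀ L → Decreasing L → OffRunner0 L → delta3bar L ≡ sgn (layeredInversions (map onRunner2 L))
barSign L dec off = cong sgn (L₃.inversions-byLayers (barNumber L) dec (runnersAreClasses₃ off) (barNumber-byLayers dec off))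

All-reverse : ∀ {P : ℕ → Set} {xs} → All P xs → All P (reverse xs)
All-reverse {xs = []}     []         = []
All-reverse {xs = x ∷ xs} (px ∷ pxs) = subst (All _) (sym (unfold-reverse x xs)) (Allₚ.∷ʳ⁺ (All-reverse pxs) px)

decreasing-∷ʳ : ∀ {xs y} → Decreasing xs → All (y <_) xs → Decreasing (xs ∷ʳ y)
decreasing-∷ʳ dec y<xs = AllPairsₚ.++⁺ dec ([] ∷ []) (All.map (_∷ []) y<xs)

decreasing-map-suc : ∀ {xs} → Decreasing xs → Decreasing (map suc xs)
decreasing-map-suc dec = AllPairsₚ.map⁺ (AllPairs.map s≤s dec)

length≤head : ∀ {x xs} → Decreasing (x ∷ xs) → length xs ≤ x
length≤head {xs = []}     _                 = z≤n
length≤head {xs = y ∷ ys} ((y<x ∷ _) ∷ dec) = <-≤-trans (s≤s (length≤head dec)) y<x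

indexed : (ℕ → ℕ) → List ℕ → List (ℕ × ℕ)
indexed f []       = []
indexed f (x ∷ xs) = (x , f 0) ∷ indexed (f ∘ suc) xs

zip-applyUpTo : ∀ (f : ℕ → ℕ) xs → zip xs (applyUpTo f (length xs)) ≡ indexed f xs
zip-applyUpTo f []       = refl
zip-applyUpTo f (x ∷ xs) = cong ((x , f 0) ∷_) (zip-applyUpTo (f ∘ suc) xs)

length-indexed : ∀ f xs → length (indexed f xs) ≡ length xs
length-indexed f []       = refl
length-indexed f (x ∷ xs) = cong suc (length-indexed (f ∘ suc) xs)

withRemaining : (ℕ → ℕ → ℕ) → List ℕ → List ℕ
withRemaining h []       = []
withRemaining h (x ∷ xs) = h x (length xs) ∷ withRemaining h xs

β β⁻¹ : List ℕ → List ℕ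
β   = withRemaining _+_
β⁻¹ = withRemaining _∸_

length-withRemaining : ∀ h xs → length (withRemaining h xs) ≡ length xs
length-withRemaining h []       = refl
length-withRemaining h (x ∷ xs) = cong suc (length-withRemaining h xs)

-- Entries are indexed from c + 1 on, so N − index is the number of entries after.
map-indexed : ∀ (h : ℕ → ℕ → ℕ) N c f xs → (∀ i → f i ≡ suc (c + i)) → N ≡ c + length xs →
  map (λ p → h (proj₁ p) (N ∸ proj₂ p)) (indexed f xs) ≡ withRemaining h xs
map-indexed h N c f []       f≡ N≡ = refl
map-indexed h N c f (x ∷ xs) f≡ N≡ =
  cong₂ _∷_ (cong (h x) remaining) (map-indexed h N (suc c) (f ∘ suc) xs f∘suc≡ (trans N≡ (+-suc c (length xs))))
  where
  f∘suc≡ : ∀ i → f (suc i) ≡ suc (suc c + i)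
  f∘suc≡ i = trans (f≡ (suc i)) (cong suc (+-suc c i))
  remaining : N ∸ f 0 ≡ length xs
  remaining = begin
    N ∸ f 0                            ≡⟨ cong₂ _∸_ N≡ (f≡ 0) ⟩
    c + suc (length xs) ∸ suc (c + 0)  ≡⟨ cong₂ _∸_ (+-suc c (length xs)) (cong suc (+-identityʳ c)) ⟩
    c + length xs ∸ c                  ≡⟨ m+n∸m≡n c (length xs) ⟩
    length xs                          ∎
    where open ≡-Reasoning

betaNumbers≡β : ∀ xs → betaNumbers xs ≡ β xs
betaNumbers≡β xs = trans (cong (map _) (zip-applyUpTo suc xs)) (map-indexed _+_ (length xs) 0 suc xs (λ _ → refl) refl)

quotientComponent≡β⁻¹ : ∀ r .{{_ : NonZero r}} λs k →
  quotientComponent r λs k ≡ β⁻¹ (map (λ x → (x ∸ k) / r) (filterᵇ (λ x → (x % r) ≡ᵇ k) (betaNumbers (padTo r λs))))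
quotientComponent≡β⁻¹ r λs k =
  trans (cong (map _) (zip-applyUpTo suc ξk)) (map-indexed _∸_ (length ξk) 0 suc ξk (λ _ → refl) refl)
  where ξk = map (λ x → (x ∸ k) / r) (filterᵇ (λ x → (x % r) ≡ᵇ k) (betaNumbers (padTo r λs)))

β-β⁻¹ : ∀ {xs} → Decreasing xs → β (β⁻¹ xs) ≡ xs
β-β⁻¹ {[]}     []            = refl
β-β⁻¹ {x ∷ xs} (below ∷ dec) =
  cong₂ _∷_ (trans (cong (x ∸ length xs +_) (length-withRemaining _∸_ xs)) (m∸n+n≡m (length≤head (below ∷ dec))))
            (β-β⁻¹ dec)

β-++ : ∀ xs ys → β (xs ++ ys) ≡ map (_+ length ys) (β xs) ++ β ys
β-++ []       ys = refl
β-++ (x ∷ xs) ys = cong₂ _∷_ (trans (cong (x +_) (length-++ xs)) (sym (+-assoc x _ _))) (β-++ xs ys)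

β-applyUpTo : ∀ (g : ℕ → ℕ) k → β (applyUpTo g k) ≡ applyUpTo (λ t → g t + (k ∸ suc t)) k
β-applyUpTo g zero    = refl
β-applyUpTo g (suc k) = cong₂ _∷_ (cong (g 0 +_) (length-applyUpTo (g ∘ suc) k)) (β-applyUpTo (g ∘ suc) k)

padEven-even : ∀ xs k → length xs ≡ k * 2 → padEven xs ≡ xs
padEven-even xs k len≡ = begin
  xs ++ applyUpTo (λ _ → 0) ((2 ∸ (length xs % 2)) % 2)
    ≡⟨ cong (λ l → xs ++ applyUpTo (λ _ → 0) ((2 ∸ (l % 2)) % 2)) len≡ ⟩
  xs ++ applyUpTo (λ _ → 0) ((2 ∸ (k * 2 % 2)) % 2)
    ≡⟨ cong (λ r → xs ++ applyUpTo (λ _ → 0) ((2 ∸ r) % 2)) (m*n%n≡0 k 2) ⟩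
  xs ++ []
    ≡⟨ ++-identityʳ xs ⟩
  xs
    ∎
  where open ≡-Reasoning

delta2-β⁻¹ : ∀ xs k → length xs ≡ k * 2 → Decreasing xs → delta2 (β⁻¹ xs) ≡ numberingSign xs (layerNumber xs)
delta2-β⁻¹ xs k len≡ dec = cong (λ ys → numberingSign ys (layerNumber ys)) (begin
  betaNumbers (padEven (β⁻¹ xs))
    ≡⟨ cong betaNumbers (padEven-even (β⁻¹ xs) k (trans (length-withRemaining _∸_ xs) len≡)) ⟩
  betaNumbers (β⁻¹ xs)
    ≡⟨ betaNumbers≡β (β⁻¹ xs) ⟩
  β (β⁻¹ xs)
    ≡⟨ β-β⁻¹ dec ⟩
  xs
    ∎)
  where open ≡-Reasoning

applyUpTo-++ : ∀ {A : Set} (f : ℕ → A) a b → applyUpTo f (a + b) ≡ applyUpTo f a ++ applyUpTo (f ∘ (a +_)) b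
applyUpTo-++ f zero    b = refl
applyUpTo-++ f (suc a) b = cong (f 0 ∷_) (applyUpTo-++ (f ∘ suc) a b)

applyUpTo-cong : ∀ {A : Set} (f g : ℕ → A) n → (∀ {i} → i < n → f i ≡ g i) → applyUpTo f n ≡ applyUpTo g n
applyUpTo-cong f g zero    f≡g = refl
applyUpTo-cong f g (suc n) f≡g = cong₂ _∷_ (f≡g z<s) (applyUpTo-cong (f ∘ suc) (g ∘ suc) n (f≡g ∘ s<s))

applyUpTo-reverse : ∀ {A : Set} (g : ℕ → A) N → applyUpTo (λ t → g (N ∸ suc t)) N ≡ reverse (applyUpTo g N)
applyUpTo-reverse g zero    = refl
applyUpTo-reverse g (suc N) = begin
  g N ∷ applyUpTo (λ t → g (N ∸ suc t)) N  ≡⟨ cong (g N ∷_) (applyUpTo-reverse g N) ⟩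
  g N ∷ reverse (applyUpTo g N)            ≡⟨ reverse-++ (applyUpTo g N) (g N ∷ []) ⟨
  reverse (applyUpTo g N ∷ʳ g N)           ≡⟨ cong reverse (applyUpTo-∷ʳ g N) ⟩
  reverse (applyUpTo g (suc N))            ∎
  where open ≡-Reasoning

-- The β-numbers of D(μ)

μ : ∀ {n} → Vec Bool n → List ℕ
μ []                = []
μ {suc n} (b ∷ I) = 3 * n + 1 + bit b ∷ μ I

addNodes≡μ : ∀ n (I : Vec Bool n) → addNodes n I ≡ μ I
addNodes≡μ zero    []      = refl
addNodes≡μ (suc n) (b ∷ I) = cong (3 * n + 1 + bit b ∷_) (addNodes≡μ n I)

length-μ : ∀ {n} (I : Vec Bool n) → length (μ I) ≡ n
length-μ []      = refl
length-μ (b ∷ I) = cong suc (length-μ I)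

μ-residue : ∀ n b → (3 * n + 1 + bit b) % 3 ≡ 1 + bit b
μ-residue n b = trans (cong (_% 3) (rearrange n (bit b))) (trans ([m+kn]%n≡m%n (1 + bit b) n 3) (byBit b))
  where
  rearrange : ∀ n c → 3 * n + 1 + c ≡ (1 + c) + n * 3
  rearrange = solve-∀
  byBit : ∀ b → (1 + bit b) % 3 ≡ 1 + bit b
  byBit true  = refl
  byBit false = refl

classes-μ : ∀ {n} (I : Vec Bool n) → map onRunner2 (μ I) ≡ toList I
classes-μ []              = refl
classes-μ {suc n} (b ∷ I) = cong₂ _∷_ (trans (cong (_≡ᵇ 2) (μ-residue n b)) (byBit b)) (classes-μ I)
  where
  byBit : ∀ b → (1 + bit b ≡ᵇ 2) ≡ b
  byBit true  = refl
  byBit false = refl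

offRunner0-μ : ∀ {n} (I : Vec Bool n) → OffRunner0 (μ I)
offRunner0-μ []              = []
offRunner0-μ {suc n} (b ∷ I) = subst (λ r → r ≡ 1 ⊎ r ≡ 2) (sym (μ-residue n b)) (byBit b) ∷ offRunner0-μ I
  where
  byBit : ∀ b → 1 + bit b ≡ 1 ⊎ 1 + bit b ≡ 2
  byBit true  = inj₂ refl
  byBit false = inj₁ refl

μ-bound : ∀ {n} (I : Vec Bool n) → All (_< 3 * n) (μ I)
μ-bound []              = []
μ-bound {suc n} (b ∷ I) = head ∷ All.map (λ x<3n → <-≤-trans x<3n (*-monoʳ-≤ 3 (n≤1+n n))) (μ-bound I)
  where
  head : 3 * n + 1 + bit b < 3 * suc n
  head = ≤-trans (s≤s (+-monoʳ-≤ (3 * n + 1) (bit≤1 b))) (≤-reflexive (rearrange n))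
    where
    rearrange : ∀ n → suc (3 * n + 1 + 1) ≡ 3 * suc n
    rearrange = solve-∀

decreasing-μ : ∀ {n} (I : Vec Bool n) → Decreasing (μ I)
decreasing-μ []              = []
decreasing-μ {suc n} (b ∷ I) = All.map (λ x<3n → <-≤-trans x<3n head≥3n) (μ-bound I) ∷ decreasing-μ I
  where
  head≥3n : 3 * n ≤ 3 * n + 1 + bit b
  head≥3n = ≤-trans (m≤m+n (3 * n) 1) (m≤m+n (3 * n + 1) (bit b))

arms : ∀ {n} → Vec Bool n → List ℕ
arms I = map (λ p → proj₁ p + proj₂ p) (indexed suc (μ I))

β-arms : ∀ f c xs → (∀ i → f i ≡ suc (c + i)) →
  β (map (λ p → proj₁ p + proj₂ p) (indexed f xs)) ≡ map (_+ (c + length xs)) xs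
β-arms f c []       f≡ = refl
β-arms f c (x ∷ xs) f≡ =
  cong₂ _∷_ head (trans (β-arms (f ∘ suc) (suc c) xs f∘suc≡) (map-cong (λ y → cong (y +_) (sym (+-suc c _))) xs))
  where
  f∘suc≡ : ∀ i → f (suc i) ≡ suc (suc c + i)
  f∘suc≡ i = trans (f≡ (suc i)) (cong suc (+-suc c i))
  head : x + f 0 + length (map (λ p → proj₁ p + proj₂ p) (indexed (f ∘ suc) xs)) ≡ x + (c + suc (length xs))
  head = begin
    x + f 0 + length (map _ (indexed (f ∘ suc) xs))
      ≡⟨ cong₂ (λ i l → x + i + l) (f≡ 0) (trans (length-map _ (indexed (f ∘ suc) xs)) (length-indexed _ xs)) ⟩
    x + suc (c + 0) + length xs
      ≡⟨ rearrange x c (length xs) ⟩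
    x + (c + suc (length xs))
      ∎
    where
    open ≡-Reasoning
    rearrange : ∀ x c l → x + suc (c + 0) + l ≡ x + (c + suc l)
    rearrange = solve-∀

legs : ∀ {n} → Vec Bool n → List ℕ
legs I = map (_∸ 1) (μ I)

-- reach i 0 b = #{j ≥ 1 : b_j + j ≥ i}, the length of row i beyond the diagonal of a Frobenius
-- symbol with legs b.
reach : ℕ → ℕ → List ℕ → ℕ
reach a c []       = 0
reach a c (x ∷ xs) = bit (a ≤ᵇ x + suc c) + reach a (suc c) xs

count-indexed : ∀ a c f xs → (∀ i → f i ≡ suc (c + i)) →
  count (λ p → a ≤ᵇ proj₁ p + proj₂ p) (indexed f xs) ≡ reach a c xs
count-indexed a c f []       f≡ = refl
count-indexed a c f (x ∷ xs) f≡ = begin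
  count P (indexed f (x ∷ xs))
    ≡⟨ count-∷ P (x , f 0) (indexed (f ∘ suc) xs) ⟩
  bit (a ≤ᵇ x + f 0) + count P (indexed (f ∘ suc) xs)
    ≡⟨ cong₂ (λ i r → bit (a ≤ᵇ x + i) + r) (trans (f≡ 0) (cong suc (+-identityʳ c)))
                                            (count-indexed a (suc c) (f ∘ suc) xs f∘suc≡) ⟩
  reach a c (x ∷ xs)
    ∎
  where
  open ≡-Reasoning
  P : ℕ × ℕ → Bool
  P p = a ≤ᵇ proj₁ p + proj₂ p
  f∘suc≡ : ∀ i → f (suc i) ≡ suc (suc c + i)
  f∘suc≡ i = trans (f≡ (suc i)) (cong suc (+-suc c i))

reach-suc : ∀ a c xs → reach (suc a) (suc c) xs ≡ reach a c xs
reach-suc a c []       = refl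
reach-suc a c (x ∷ xs) =
  cong₂ (λ t r → bit t + r) (trans (cong (suc a ≤ᵇ_) (+-suc x (suc c))) (<ᵇ-suc a (x + suc c))) (reach-suc a (suc c) xs)

-- 3j and 3j + 1 + b_j for every row j (counted from the top, from 0): the β-numbers of D(μ) below 3ℓ
lowBeta : ∀ {n} → Vec Bool n → ℕ → ℕ
lowBeta []      s             = 0
lowBeta (b ∷ I) zero          = 0
lowBeta (b ∷ I) (suc zero)    = 1 + bit b
lowBeta (b ∷ I) (suc (suc s)) = 3 + lowBeta I s

private
  leg-head : ∀ n b → 3 * n + 1 + bit b ∸ 1 ≡ 3 * n + bit b
  leg-head n b = cong (_∸ 1) (trans (+-assoc (3 * n) 1 (bit b)) (+-suc (3 * n) (bit b)))

  reach-head : ∀ a n b xs →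
    reach a 0 ((3 * n + 1 + bit b ∸ 1) ∷ xs) ≡ bit (a ≤ᵇ 3 * n + bit b + 1) + reach a 1 xs
  reach-head a n b xs = cong (λ x → bit (a ≤ᵇ x + 1) + reach a 1 xs) (leg-head n b)

reach-vanishes  : ∀ {n} b (I : Vec Bool n) a → 3 * n + 2 + bit b ≤ a → reach a 0 (legs (b ∷ I)) ≡ 0
reach-vanishes₀ : ∀ {n} (I : Vec Bool n) a → 3 * n ≤ a → reach a 0 (legs I) ≡ 0

reach-vanishes {n} b I a bound = begin
  reach a 0 (legs (b ∷ I))
    ≡⟨ reach-head a n b (legs I) ⟩
  bit (a ≤ᵇ 3 * n + bit b + 1) + reach a 1 (legs I)
    ≡⟨ cong₂ (λ t r → bit t + r) (≤ᵇ-false head<a) (tail a 3n<a) ⟩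
  0
    ∎
  where
  open ≡-Reasoning
  head<a : 3 * n + bit b + 1 < a
  head<a = ≤-trans (≤-reflexive (rearrange (3 * n) (bit b))) bound
    where
    rearrange : ∀ x c → suc (x + c + 1) ≡ x + 2 + c
    rearrange = solve-∀
  3n<a : 3 * n < a
  3n<a = <-≤-trans (m<m+n (3 * n) {2 + bit b} z<s) (≤-trans (≤-reflexive (sym (+-assoc (3 * n) 2 (bit b)))) bound)
  tail : ∀ a → 3 * n < a → reach a 1 (legs I) ≡ 0
  tail (suc a) (s≤s 3n≤a) = trans (reach-suc a 0 (legs I)) (reach-vanishes₀ I a 3n≤a)

reach-vanishes₀ []      a _     = refl
reach-vanishes₀ {suc n} (b ∷ I) a bound = reach-vanishes b I a (≤-trans (three n b) bound)
  where
  three : ∀ n b → 3 * n + 2 + bit b ≤ 3 * suc n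
  three n b = ≤-trans (+-monoʳ-≤ (3 * n + 2) (bit≤1 b)) (≤-reflexive (solve n))
    where
    solve : ∀ n → 3 * n + 2 + 1 ≡ 3 * suc n
    solve = solve-∀

-- The β-number of a row a of D(μ) below the diagonal, with s = 3ℓ − a rows under it.
reach+≡lowBeta : ∀ {n} (I : Vec Bool n) a s → a + s ≡ 3 * n → s < 2 * n → reach a 0 (legs I) + s ≡ lowBeta I s
reach+≡lowBeta {suc n} (b ∷ I) a zero a≡ _ =
  cong (_+ 0) (reach-vanishes₀ (b ∷ I) a (≤-reflexive (trans (sym a≡) (+-identityʳ a))))
reach+≡lowBeta {suc n} (b ∷ I) a (suc zero) a≡ _ =
  subst (λ a → reach a 0 (legs (b ∷ I)) + 1 ≡ 1 + bit b) (sym a≡2+3n) (begin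
  reach (2 + 3 * n) 0 (legs (b ∷ I)) + 1
    ≡⟨ cong (_+ 1) (reach-head (2 + 3 * n) n b (legs I)) ⟩
  bit (2 + 3 * n ≤ᵇ 3 * n + bit b + 1) + reach (2 + 3 * n) 1 (legs I) + 1
    ≡⟨ cong₂ (λ t r → bit t + r + 1) (head b) below ⟩
  bit b + 0 + 1
    ≡⟨ cong (_+ 1) (+-identityʳ (bit b)) ⟩
  bit b + 1
    ≡⟨ +-comm (bit b) 1 ⟩
  1 + bit b
    ∎)
  where
  open ≡-Reasoning
  below : reach (2 + 3 * n) 1 (legs I) ≡ 0
  below = trans (reach-suc (suc (3 * n)) 0 (legs I)) (reach-vanishes₀ I (suc (3 * n)) (n≤1+n _))
  a≡2+3n : a ≡ 2 + 3 * n
  a≡2+3n = +-cancelʳ-≡ 1 a (2 + 3 * n) (trans a≡ (rearrange n))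
    where
    rearrange : ∀ n → 3 * suc n ≡ 2 + 3 * n + 1
    rearrange = solve-∀
  head : ∀ b → (2 + 3 * n ≤ᵇ 3 * n + bit b + 1) ≡ b
  head true  = ≤ᵇ-true (≤-reflexive (rearrange n))
    where
    rearrange : ∀ n → 2 + 3 * n ≡ 3 * n + 1 + 1
    rearrange = solve-∀
  head false = ≤ᵇ-false (≤-reflexive (rearrange n))
    where
    rearrange : ∀ n → suc (3 * n + 0 + 1) ≡ 2 + 3 * n
    rearrange = solve-∀
reach+≡lowBeta {suc n} (b ∷ I) zero (suc (suc s)) a≡ s<2n =
  contradiction a≡ (<⇒≢ (<-≤-trans s<2n (*-monoˡ-≤ (suc n) {2} {3} (s≤s (s≤s z≤n)))))
reach+≡lowBeta {suc n} (b ∷ I) (suc a) (suc (suc s)) a≡ s<2n = begin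
  reach (suc a) 0 (legs (b ∷ I)) + suc (suc s)
    ≡⟨ cong (_+ suc (suc s)) (reach-head (suc a) n b (legs I)) ⟩
  bit (suc a ≤ᵇ 3 * n + bit b + 1) + reach (suc a) 1 (legs I) + suc (suc s)
    ≡⟨ cong₂ (λ t r → bit t + r + suc (suc s)) (≤ᵇ-true a<) (reach-suc a 0 (legs I)) ⟩
  1 + reach a 0 (legs I) + suc (suc s)
    ≡⟨ rearrange (reach a 0 (legs I)) s ⟩
  3 + (reach a 0 (legs I) + s)
    ≡⟨ cong (3 +_) (reach+≡lowBeta I a s a+s≡ s<) ⟩
  3 + lowBeta I s
    ∎
  where
  open ≡-Reasoning
  rearrange : ∀ r s → 1 + r + suc (suc s) ≡ 3 + (r + s)
  rearrange = solve-∀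
  a+s≡ : a + s ≡ 3 * n
  a+s≡ = +-cancelˡ-≡ 3 (a + s) (3 * n) (trans (shift a s) (trans a≡ (*-suc 3 n)))
    where
    shift : ∀ a s → 3 + (a + s) ≡ suc a + suc (suc s)
    shift = solve-∀
  s< : s < 2 * n
  s< = ≤-pred (≤-pred (<-≤-trans s<2n (≤-reflexive (*-suc 2 n))))
  a< : suc a ≤ 3 * n + bit b + 1
  a< = ≤-trans (≤-reflexive (+-comm 1 a)) (+-monoˡ-≤ 1 (≤-trans (m≤m+n a s) (≤-trans (≤-reflexive a+s≡) (m≤m+n (3 * n) (bit b)))))

legRow : ∀ {n} → Bool → Vec Bool n → ℕ → ℕ
legRow {n} b I t = reach (suc (suc n + t)) 0 (legs (b ∷ I))

doubleD≡ : ∀ {n} b (I : Vec Bool n) → doubleD (μ (b ∷ I)) ≡ arms (b ∷ I) ++ applyUpTo (legRow b I) (2 * n + bit b)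
doubleD≡ {n} b I = cong₂ _++_ (cong (map _) (zip-applyUpTo suc (μ (b ∷ I))))
                              (trans (applyUpTo-cong _ _ _ (λ {t} _ → row t)) (cong (applyUpTo (legRow b I)) rowCount))
  where
  P : ℕ → ℕ × ℕ → Bool
  P t p = suc (length (μ (b ∷ I)) + t) ≤ᵇ proj₁ p + proj₂ p
  row : ∀ t → count (P t) (zip (legs (b ∷ I)) (applyUpTo suc (length (legs (b ∷ I))))) ≡ legRow b I t
  row t = begin
    count (P t) (zip (legs (b ∷ I)) (applyUpTo suc (length (legs (b ∷ I)))))
      ≡⟨ cong (count (P t)) (zip-applyUpTo suc (legs (b ∷ I))) ⟩
    count (P t) (indexed suc (legs (b ∷ I)))
      ≡⟨ count-indexed _ 0 suc (legs (b ∷ I)) (λ _ → refl) ⟩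
    reach (suc (length (μ (b ∷ I)) + t)) 0 (legs (b ∷ I))
      ≡⟨ cong (λ l → reach (suc (l + t)) 0 (legs (b ∷ I))) (length-μ (b ∷ I)) ⟩
    legRow b I t
      ∎
    where open ≡-Reasoning
  rowCount : 3 * n + 1 + bit b ∸ 1 ∸ length (μ I) ≡ 2 * n + bit b
  rowCount = begin
    3 * n + 1 + bit b ∸ 1 ∸ length (μ I)  ≡⟨ cong₂ _∸_ (leg-head n b) (length-μ I) ⟩
    3 * n + bit b ∸ n                     ≡⟨ cong (_∸ n) (rearrange n (bit b)) ⟩
    n + (2 * n + bit b) ∸ n               ≡⟨ m+n∸m≡n n (2 * n + bit b) ⟩
    2 * n + bit b                         ∎
    where
    open ≡-Reasoning
    rearrange : ∀ n c → 3 * n + c ≡ n + (2 * n + c)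
    rearrange = solve-∀

padLength : Bool → ℕ
padLength b = 2 ∸ bit b

private
  rows+pad : ∀ n b → 2 * n + bit b + padLength b ≡ 2 * suc n
  rows+pad n true  = solve n
    where
    solve : ∀ n → 2 * n + 1 + 1 ≡ 2 * suc n
    solve = solve-∀
  rows+pad n false = solve n
    where
    solve : ∀ n → 2 * n + 0 + 2 ≡ 2 * suc n
    solve = solve-∀

-- Padding to a multiple of 3 appends empty rows, which continue the rows of D(μ) below the diagonal.
padTo-doubleD : ∀ {n} b (I : Vec Bool n) →
  padTo 3 (doubleD (μ (b ∷ I))) ≡ arms (b ∷ I) ++ applyUpTo (legRow b I) (2 * suc n)
padTo-doubleD {n} b I = begin
  padTo 3 (doubleD (μ (b ∷ I)))
    ≡⟨ cong (padTo 3) (doubleD≡ b I) ⟩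
  padTo 3 (arms (b ∷ I) ++ rows)
    ≡⟨ cong (λ k → (arms (b ∷ I) ++ rows) ++ applyUpTo (λ _ → 0) k) padCount ⟩
  (arms (b ∷ I) ++ rows) ++ applyUpTo (λ _ → 0) (padLength b)
    ≡⟨ ++-assoc (arms (b ∷ I)) rows _ ⟩
  arms (b ∷ I) ++ rows ++ applyUpTo (λ _ → 0) (padLength b)
    ≡⟨ cong (arms (b ∷ I) ++_) emptyRows ⟩
  arms (b ∷ I) ++ applyUpTo (legRow b I) (2 * suc n)
    ∎
  where
  open ≡-Reasoning
  K = 2 * n + bit b
  rows = applyUpTo (legRow b I) K
  length-arms : length (arms (b ∷ I)) ≡ suc n
  length-arms = trans (length-map _ (indexed suc (μ (b ∷ I)))) (trans (length-indexed suc (μ (b ∷ I))) (length-μ (b ∷ I)))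
  length≡ : length (arms (b ∷ I) ++ rows) ≡ (1 + bit b) + n * 3
  length≡ = begin
    length (arms (b ∷ I) ++ rows)        ≡⟨ length-++ (arms (b ∷ I)) ⟩
    length (arms (b ∷ I)) + length rows  ≡⟨ cong₂ _+_ length-arms (length-applyUpTo (legRow b I) K) ⟩
    suc n + (2 * n + bit b)              ≡⟨ rearrange n (bit b) ⟩
    (1 + bit b) + n * 3                  ∎
    where
    rearrange : ∀ n c → suc n + (2 * n + c) ≡ (1 + c) + n * 3
    rearrange = solve-∀
  padCount : (3 ∸ (length (arms (b ∷ I) ++ rows) % 3)) % 3 ≡ padLength b
  padCount = begin
    (3 ∸ (length (arms (b ∷ I) ++ rows) % 3)) % 3  ≡⟨ cong (λ l → (3 ∸ (l % 3)) % 3) length≡ ⟩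
    (3 ∸ ((1 + bit b) + n * 3) % 3) % 3            ≡⟨ cong (λ r → (3 ∸ r) % 3) ([m+kn]%n≡m%n (1 + bit b) n 3) ⟩
    (3 ∸ ((1 + bit b) % 3)) % 3                    ≡⟨ byBit b ⟩
    padLength b                                    ∎
    where
    byBit : ∀ b → (3 ∸ ((1 + bit b) % 3)) % 3 ≡ padLength b
    byBit true  = refl
    byBit false = refl
  emptyRows : rows ++ applyUpTo (λ _ → 0) (padLength b) ≡ applyUpTo (legRow b I) (2 * suc n)
  emptyRows = begin
    rows ++ applyUpTo (λ _ → 0) (padLength b)
      ≡⟨ cong (rows ++_) (applyUpTo-cong _ _ (padLength b) (λ {i} _ → sym (vanishes i))) ⟩
    rows ++ applyUpTo (legRow b I ∘ (K +_)) (padLength b)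
      ≡⟨ applyUpTo-++ (legRow b I) K (padLength b) ⟨
    applyUpTo (legRow b I) (K + padLength b)
      ≡⟨ cong (applyUpTo (legRow b I)) (rows+pad n b) ⟩
    applyUpTo (legRow b I) (2 * suc n)
      ∎
    where
    vanishes : ∀ i → legRow b I (K + i) ≡ 0
    vanishes i = reach-vanishes b I _ (≤-trans (m≤m+n (3 * n + 2 + bit b) i) (≤-reflexive (rearrange n (bit b) i)))
      where
      rearrange : ∀ n c i → 3 * n + 2 + c + i ≡ suc (suc n + (2 * n + c + i))
      rearrange = solve-∀

betaNumbers-D : ∀ {n} b (I : Vec Bool n) → betaNumbers (padTo 3 (doubleD (μ (b ∷ I))))
  ≡ map (_+ 3 * suc n) (μ (b ∷ I)) ++ reverse (applyUpTo (lowBeta (b ∷ I)) (2 * suc n))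
betaNumbers-D {n} b I = begin
  betaNumbers (padTo 3 (doubleD (μ (b ∷ I))))
    ≡⟨ betaNumbers≡β _ ⟩
  β (padTo 3 (doubleD (μ (b ∷ I))))
    ≡⟨ cong β (padTo-doubleD b I) ⟩
  β (arms (b ∷ I) ++ applyUpTo (legRow b I) M)
    ≡⟨ β-++ (arms (b ∷ I)) _ ⟩
  map (_+ length (applyUpTo (legRow b I) M)) (β (arms (b ∷ I))) ++ β (applyUpTo (legRow b I) M)
    ≡⟨ cong₂ _++_ top bottom ⟩
  map (_+ 3 * suc n) (μ (b ∷ I)) ++ reverse (applyUpTo (lowBeta (b ∷ I)) M)
    ∎
  where
  open ≡-Reasoning
  M = 2 * suc n
  top : map (_+ length (applyUpTo (legRow b I) M)) (β (arms (b ∷ I))) ≡ map (_+ 3 * suc n) (μ (b ∷ I))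
  top = begin
    map (_+ length (applyUpTo (legRow b I) M)) (β (arms (b ∷ I)))
      ≡⟨ cong₂ map (cong (λ l → _+ l) (length-applyUpTo (legRow b I) M)) (β-arms suc 0 (μ (b ∷ I)) (λ _ → refl)) ⟩
    map (_+ M) (map (_+ (0 + length (μ (b ∷ I)))) (μ (b ∷ I)))
      ≡⟨ map-∘ (μ (b ∷ I)) ⟨
    map (λ x → x + (0 + length (μ (b ∷ I))) + M) (μ (b ∷ I))
      ≡⟨ map-cong (λ x → cong (λ l → x + l + M) (length-μ (b ∷ I))) (μ (b ∷ I)) ⟩
    map (λ x → x + suc n + M) (μ (b ∷ I))
      ≡⟨ map-cong (λ x → rearrange x n) (μ (b ∷ I)) ⟩
    map (_+ 3 * suc n) (μ (b ∷ I))
      ∎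
    where
    rearrange : ∀ x n → x + suc n + 2 * suc n ≡ x + 3 * suc n
    rearrange = solve-∀
  depth : ∀ {t} → t < M → suc (suc n + t) + (M ∸ suc t) ≡ 3 * suc n
  depth {t} t<M = begin
    suc (suc n + t) + (M ∸ suc t)  ≡⟨ rearrange (suc n) t (M ∸ suc t) ⟩
    suc n + (M ∸ suc t + suc t)    ≡⟨ cong (suc n +_) (m∸n+n≡m t<M) ⟩
    suc n + M                      ≡⟨ solve n ⟩
    3 * suc n                      ∎
    where
    rearrange : ∀ n t d → suc (n + t) + d ≡ n + (d + suc t)
    rearrange = solve-∀
    solve : ∀ n → suc n + 2 * suc n ≡ 3 * suc n
    solve = solve-∀
  bottom : β (applyUpTo (legRow b I) M) ≡ reverse (applyUpTo (lowBeta (b ∷ I)) M)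
  bottom = begin
    β (applyUpTo (legRow b I) M)
      ≡⟨ β-applyUpTo (legRow b I) M ⟩
    applyUpTo (λ t → legRow b I t + (M ∸ suc t)) M
      ≡⟨ applyUpTo-cong _ _ M (λ {t} t<M → reach+≡lowBeta (b ∷ I) _ (M ∸ suc t) (depth t<M) (s≤s (m∸n≤m _ t))) ⟩
    applyUpTo (λ t → lowBeta (b ∷ I) (M ∸ suc t)) M
      ≡⟨ applyUpTo-reverse (lowBeta (b ∷ I)) M ⟩
    reverse (applyUpTo (lowBeta (b ∷ I)) M)
      ∎

-- The runner-1 component ξ^(1)

runner₁ : List ℕ → List ℕ
runner₁ = map (λ x → (x ∸ 1) / 3) ∘ filterᵇ (λ x → x % 3 ≡ᵇ 1)

runner₁-∷ : ∀ x xs → runner₁ (x ∷ xs) ≡ (if x % 3 ≡ᵇ 1 then (x ∸ 1) / 3 ∷ runner₁ xs else runner₁ xs)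
runner₁-∷ x xs with x % 3 ≡ᵇ 1
... | true  = refl
... | false = refl

runner₁-++ : ∀ xs ys → runner₁ (xs ++ ys) ≡ runner₁ xs ++ runner₁ ys
runner₁-++ xs ys =
  trans (cong (map _) (filter-++ (T? ∘ on₁) xs ys)) (map-++ (λ x → (x ∸ 1) / 3) (filterᵇ on₁ xs) (filterᵇ on₁ ys))
  where
  on₁ : ℕ → Bool
  on₁ x = x % 3 ≡ᵇ 1

runner₁-reverse : ∀ xs → runner₁ (reverse xs) ≡ reverse (runner₁ xs)
runner₁-reverse []       = refl
runner₁-reverse (x ∷ xs) = begin
  runner₁ (reverse (x ∷ xs))                ≡⟨ cong runner₁ (unfold-reverse x xs) ⟩
  runner₁ (reverse xs ++ x ∷ [])            ≡⟨ runner₁-++ (reverse xs) (x ∷ []) ⟩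
  runner₁ (reverse xs) ++ runner₁ (x ∷ [])  ≡⟨ cong (_++ runner₁ (x ∷ [])) (runner₁-reverse xs) ⟩
  reverse (runner₁ xs) ++ runner₁ (x ∷ [])  ≡⟨ snoc (x % 3 ≡ᵇ 1) (runner₁-∷ x xs) (runner₁-∷ x []) ⟩
  reverse (runner₁ (x ∷ xs))                ∎
  where
  open ≡-Reasoning
  snoc : ∀ c → runner₁ (x ∷ xs) ≡ (if c then (x ∸ 1) / 3 ∷ runner₁ xs else runner₁ xs) →
               runner₁ (x ∷ []) ≡ (if c then (x ∸ 1) / 3 ∷ [] else []) →
         reverse (runner₁ xs) ++ runner₁ (x ∷ []) ≡ reverse (runner₁ (x ∷ xs))
  snoc true  eq eq′ rewrite eq | eq′ = sym (unfold-reverse _ (runner₁ xs))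
  snoc false eq eq′ rewrite eq | eq′ = ++-identityʳ _

private
  mod3 : ∀ x → (3 + x) % 3 ≡ x % 3
  mod3 x = trans (cong (_% 3) (+-comm 3 x)) ([m+kn]%n≡m%n x 1 3)

runner₁-3+ : ∀ xs → runner₁ (map (3 +_) xs) ≡ map suc (runner₁ xs)
runner₁-3+ []       = refl
runner₁-3+ (x ∷ xs) rewrite runner₁-∷ (3 + x) (map (3 +_) xs) | runner₁-∷ x xs | mod3 x with x % 3 ≡ᵇ 1 in on₁
... | true  = cong₂ _∷_ (div3 x on₁) (runner₁-3+ xs)
  where
  div3 : ∀ x → (x % 3 ≡ᵇ 1) ≡ true → (3 + x ∸ 1) / 3 ≡ suc ((x ∸ 1) / 3)
  div3 (suc y) _ = m/n≡1+[m∸n]/n {3 + y} {3} (s≤s (s≤s (s≤s z≤n)))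
... | false = runner₁-3+ xs

runner₁-μ-entry : ∀ b k xs → runner₁ ((1 + bit b) + k * 3 ∷ xs) ≡ (if b then runner₁ xs else k ∷ runner₁ xs)
runner₁-μ-entry b k xs = begin
  runner₁ (x ∷ xs)
    ≡⟨ runner₁-∷ x xs ⟩
  (if x % 3 ≡ᵇ 1 then (x ∸ 1) / 3 ∷ runner₁ xs else runner₁ xs)
    ≡⟨ cong (λ r → if r ≡ᵇ 1 then (x ∸ 1) / 3 ∷ runner₁ xs else runner₁ xs) ([m+kn]%n≡m%n (1 + bit b) k 3) ⟩
  (if (1 + bit b) % 3 ≡ᵇ 1 then (x ∸ 1) / 3 ∷ runner₁ xs else runner₁ xs)
    ≡⟨ byBit b ⟩
  (if b then runner₁ xs else k ∷ runner₁ xs)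
    ∎
  where
  open ≡-Reasoning
  x = (1 + bit b) + k * 3
  byBit : ∀ b → (if (1 + bit b) % 3 ≡ᵇ 1 then ((1 + bit b) + k * 3 ∸ 1) / 3 ∷ runner₁ xs else runner₁ xs)
              ≡ (if b then runner₁ xs else k ∷ runner₁ xs)
  byBit true  = refl
  byBit false = cong (_∷ runner₁ xs) (m*n/n≡m k 3)

holes : ∀ {n} → Vec Bool n → List ℕ
holes []      = []
holes (b ∷ I) = if b then map suc (holes I) else 0 ∷ map suc (holes I)

holesᵒᵖ : ∀ {n} → Vec Bool n → List ℕ
holesᵒᵖ []              = []
holesᵒᵖ {suc n} (b ∷ I) = if b then holesᵒᵖ I else n ∷ holesᵒᵖ I

runner₁-arms : ∀ {n} (I : Vec Bool n) N → runner₁ (map (_+ 3 * N) (μ I)) ≡ map (_+ N) (holesᵒᵖ I)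
runner₁-arms []              N = refl
runner₁-arms {suc n} (b ∷ I) N = begin
  runner₁ (3 * n + 1 + bit b + 3 * N ∷ rest)
    ≡⟨ cong (λ x → runner₁ (x ∷ rest)) (rearrange n (bit b) N) ⟩
  runner₁ ((1 + bit b) + (n + N) * 3 ∷ rest)
    ≡⟨ runner₁-μ-entry b (n + N) rest ⟩
  (if b then runner₁ rest else n + N ∷ runner₁ rest)
    ≡⟨ byBit b ⟩
  map (_+ N) (holesᵒᵖ (b ∷ I))
    ∎
  where
  open ≡-Reasoning
  rest = map (_+ 3 * N) (μ I)
  rearrange : ∀ n c N → 3 * n + 1 + c + 3 * N ≡ (1 + c) + (n + N) * 3
  rearrange = solve-∀
  byBit : ∀ b → (if b then runner₁ rest else n + N ∷ runner₁ rest) ≡ map (_+ N) (holesᵒᵖ (b ∷ I))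
  byBit true  = runner₁-arms I N
  byBit false = cong (n + N ∷_) (runner₁-arms I N)

runner₁-low : ∀ {n} (I : Vec Bool n) → runner₁ (applyUpTo (lowBeta I) (2 * n)) ≡ holes I
runner₁-low []              = refl
runner₁-low {suc n} (b ∷ I) = begin
  runner₁ (applyUpTo (lowBeta (b ∷ I)) (2 * suc n))
    ≡⟨ cong (runner₁ ∘ applyUpTo (lowBeta (b ∷ I))) (*-suc 2 n) ⟩
  runner₁ (0 ∷ (1 + bit b) ∷ applyUpTo (λ t → 3 + lowBeta I t) (2 * n))
    ≡⟨ cong (λ l → runner₁ (0 ∷ (1 + bit b) ∷ l)) (map-applyUpTo (lowBeta I) (3 +_) (2 * n)) ⟨
  runner₁ (0 ∷ (1 + bit b) ∷ map (3 +_) (applyUpTo (lowBeta I) (2 * n)))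
    ≡⟨ byBit b ⟩
  holes (b ∷ I)
    ∎
  where
  open ≡-Reasoning
  shifted : runner₁ (map (3 +_) (applyUpTo (lowBeta I) (2 * n))) ≡ map suc (holes I)
  shifted = trans (runner₁-3+ (applyUpTo (lowBeta I) (2 * n))) (cong (map suc) (runner₁-low I))
  byBit : ∀ b → runner₁ (0 ∷ (1 + bit b) ∷ map (3 +_) (applyUpTo (lowBeta I) (2 * n))) ≡ holes (b ∷ I)
  byBit true  = shifted
  byBit false = cong (0 ∷_) shifted

ξ₁ : ∀ {n} → Vec Bool n → List ℕ
ξ₁ {n} I = map (_+ n) (holesᵒᵖ I) ++ reverse (holes I)

runner₁-betaNumbers-D : ∀ {n} b (I : Vec Bool n) →
  runner₁ (betaNumbers (padTo 3 (doubleD (μ (b ∷ I))))) ≡ ξ₁ (b ∷ I)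
runner₁-betaNumbers-D {n} b I = begin
  runner₁ (betaNumbers (padTo 3 (doubleD (μ (b ∷ I)))))
    ≡⟨ cong runner₁ (betaNumbers-D b I) ⟩
  runner₁ (map (_+ 3 * suc n) (μ (b ∷ I)) ++ reverse low)
    ≡⟨ runner₁-++ (map (_+ 3 * suc n) (μ (b ∷ I))) (reverse low) ⟩
  runner₁ (map (_+ 3 * suc n) (μ (b ∷ I))) ++ runner₁ (reverse low)
    ≡⟨ cong₂ _++_ (runner₁-arms (b ∷ I) (suc n)) (trans (runner₁-reverse low) (cong reverse (runner₁-low (b ∷ I)))) ⟩
  ξ₁ (b ∷ I)
    ∎
  where
  open ≡-Reasoning
  low = applyUpTo (lowBeta (b ∷ I)) (2 * suc n)

barQuot1-μ : ∀ {n} b (I : Vec Bool n) → barQuot1 (μ (b ∷ I)) ≡ β⁻¹ (ξ₁ (b ∷ I))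
barQuot1-μ b I = trans (quotientComponent≡β⁻¹ 3 (doubleD (μ (b ∷ I))) 1) (cong β⁻¹ (runner₁-betaNumbers-D b I))

holes-bound : ∀ {n} (I : Vec Bool n) → All (_< n) (holes I)
holes-bound []          = []
holes-bound (true ∷ I)  = Allₚ.map⁺ (All.map s≤s (holes-bound I))
holes-bound (false ∷ I) = z<s ∷ Allₚ.map⁺ (All.map s≤s (holes-bound I))

holesᵒᵖ-bound : ∀ {n} (I : Vec Bool n) → All (_< n) (holesᵒᵖ I)
holesᵒᵖ-bound []          = []
holesᵒᵖ-bound (true ∷ I)  = All.map m<n⇒m<1+n (holesᵒᵖ-bound I)
holesᵒᵖ-bound (false ∷ I) = ≤-refl ∷ All.map m<n⇒m<1+n (holesᵒᵖ-bound I)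

holesᵒᵖ≡ : ∀ {n} (I : Vec Bool n) → holesᵒᵖ I ≡ map (λ j → n ∸ 1 ∸ j) (holes I)
holesᵒᵖ≡ []              = refl
holesᵒᵖ≡ {suc n} (b ∷ I) = byBit b
  where
  shifted : holesᵒᵖ I ≡ map (n ∸_) (map suc (holes I))
  shifted = trans (holesᵒᵖ≡ I) (trans (map-cong (λ j → ∸-+-assoc n 1 j) (holes I)) (map-∘ (holes I)))
  byBit : ∀ b → holesᵒᵖ (b ∷ I) ≡ map (λ j → suc n ∸ 1 ∸ j) (holes (b ∷ I))
  byBit true  = shifted
  byBit false = cong (n ∷_) shifted

length-ξ₁ : ∀ {n} (I : Vec Bool n) → length (ξ₁ I) ≡ length (holes I) * 2
length-ξ₁ {n} I = begin
  length (map (_+ n) (holesᵒᵖ I) ++ reverse (holes I))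
    ≡⟨ length-++ (map (_+ n) (holesᵒᵖ I)) ⟩
  length (map (_+ n) (holesᵒᵖ I)) + length (reverse (holes I))
    ≡⟨ cong₂ _+_ (trans (length-map _ (holesᵒᵖ I)) (trans (cong length (holesᵒᵖ≡ I)) (length-map _ (holes I))))
                 (length-reverse (holes I)) ⟩
  length (holes I) + length (holes I)
    ≡⟨ solve (length (holes I)) ⟩
  length (holes I) * 2
    ∎
  where
  open ≡-Reasoning
  solve : ∀ h → h + h ≡ h * 2
  solve = solve-∀

decreasing-holesᵒᵖ : ∀ {n} (I : Vec Bool n) → Decreasing (holesᵒᵖ I)
decreasing-holesᵒᵖ []          = []
decreasing-holesᵒᵖ (true ∷ I)  = decreasing-holesᵒᵖ I
decreasing-holesᵒᵖ (false ∷ I) = holesᵒᵖ-bound I ∷ decreasing-holesᵒᵖ I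

decreasing-reverse-holes     : ∀ {n} (I : Vec Bool n) → Decreasing (reverse (holes I))
decreasing-reverse-suc-holes : ∀ {n} (I : Vec Bool n) → Decreasing (reverse (map suc (holes I)))

decreasing-reverse-holes []          = []
decreasing-reverse-holes (true ∷ I)  = decreasing-reverse-suc-holes I
decreasing-reverse-holes (false ∷ I) =
  subst Decreasing (sym (unfold-reverse 0 (map suc (holes I))))
        (decreasing-∷ʳ (decreasing-reverse-suc-holes I) (All-reverse (Allₚ.map⁺ (All.universal (λ _ → z<s) (holes I)))))

decreasing-reverse-suc-holes I =
  subst Decreasing (reverse-map suc (holes I)) (decreasing-map-suc (decreasing-reverse-holes I))

decreasing-ξ₁ : ∀ {n} (I : Vec Bool n) → Decreasing (ξ₁ I)
decreasing-ξ₁ {n} I = AllPairsₚ.++⁺ (AllPairsₚ.map⁺ (AllPairs.map (+-monoˡ-< n) (decreasing-holesᵒᵖ I)))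
                                    (decreasing-reverse-holes I)
                                    (Allₚ.map⁺ (All.universal above (holesᵒᵖ I)))
  where
  above : ∀ x → All (x + n >_) (reverse (holes I))
  above x = All.map (λ j<n → <-≤-trans j<n (m≤n+m n x)) (All-reverse (holes-bound I))

-- Parities of the class words

trueTailLengths : List Bool → ℕ
trueTailLengths []      = 0
trueTailLengths (a ∷ w) = (if a then length w else 0) + trueTailLengths w

C2-∸-sucˡ : ∀ t f → (t ∸ f) C 2 + (f ∸ t) + 2 * t ≡ t + f + (suc t ∸ f) C 2
C2-∸-sucˡ t       zero    = begin
  t C 2 + (0 ∸ t) + 2 * t     ≡⟨ cong (λ z → t C 2 + z + 2 * t) (0∸n≡0 t) ⟩
  t C 2 + 0 + 2 * t           ≡⟨ rearrange t (t C 2) ⟩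
  t + 0 + (t + t C 2)         ≡⟨ cong (t + 0 +_) (C2-suc t) ⟨
  t + 0 + suc t C 2           ∎
  where
  open ≡-Reasoning
  rearrange : ∀ t x → x + 0 + 2 * t ≡ t + 0 + (t + x)
  rearrange = solve-∀
C2-∸-sucˡ zero    (suc f) rewrite 0∸n≡0 f = refl
C2-∸-sucˡ (suc t) (suc f) = trans (shift ((t ∸ f) C 2 + (f ∸ t)) t) (trans (cong (2 +_) (C2-∸-sucˡ t f)) (shift′ t f _))
  where
  shift : ∀ a t → a + 2 * suc t ≡ 2 + (a + 2 * t)
  shift = solve-∀
  shift′ : ∀ t f c → 2 + (t + f + c) ≡ suc t + suc f + c
  shift′ = solve-∀

C2-∸-sucʳ : ∀ t f → (t ∸ f) C 2 + (t ∸ suc f) ≡ (t ∸ suc f) C 2 + 2 * (t ∸ suc f)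
C2-∸-sucʳ zero    f       rewrite 0∸n≡0 f = refl
C2-∸-sucʳ (suc t) zero    = trans (cong (_+ t) (C2-suc t)) (rearrange t (t C 2))
  where
  rearrange : ∀ t x → t + x + t ≡ x + 2 * t
  rearrange = solve-∀
C2-∸-sucʳ (suc t) (suc f) = C2-∸-sucʳ t f

layeredInversions-≡₂ : ∀ w → layeredInversions w ≡₂ trueTailLengths w + (count id w ∸ count not w) C 2
layeredInversions-≡₂ []          = ≡₂.refl
layeredInversions-≡₂ (true ∷ w)  = begin
  layeredInversions w + (f ∸ t)                 ≈⟨ +-≡₂ (layeredInversions-≡₂ w) ≡₂.refl ⟩
  s + (t ∸ f) C 2 + (f ∸ t)                     ≈⟨ +-double-≡₂ _ t ⟨
  s + (t ∸ f) C 2 + (f ∸ t) + 2 * t             ≡⟨ reassoc s ((t ∸ f) C 2) (f ∸ t) t ⟩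
  s + ((t ∸ f) C 2 + (f ∸ t) + 2 * t)           ≡⟨ cong (s +_) (C2-∸-sucˡ t f) ⟩
  s + (t + f + (suc t ∸ f) C 2)                 ≡⟨ reorder s (t + f) ((suc t ∸ f) C 2) ⟩
  t + f + s + (suc t ∸ f) C 2                   ≡⟨ cong (λ l → l + s + (suc t ∸ f) C 2) (count+count-not id w) ⟩
  length w + s + (suc t ∸ f) C 2                ∎
  where
  open ≡₂-Reasoning
  s = trueTailLengths w
  t = count id w
  f = count not w
  reassoc : ∀ s a b t → s + a + b + 2 * t ≡ s + (a + b + 2 * t)
  reassoc = solve-∀
  reorder : ∀ s l c → s + (l + c) ≡ l + s + c
  reorder = solve-∀
layeredInversions-≡₂ (false ∷ w) = begin
  layeredInversions w + (t ∸ suc f)             ≈⟨ +-≡₂ (layeredInversions-≡₂ w) ≡₂.refl ⟩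
  s + (t ∸ f) C 2 + (t ∸ suc f)                 ≡⟨ +-assoc s _ _ ⟩
  s + ((t ∸ f) C 2 + (t ∸ suc f))               ≡⟨ cong (s +_) (C2-∸-sucʳ t f) ⟩
  s + ((t ∸ suc f) C 2 + 2 * (t ∸ suc f))       ≡⟨ +-assoc s _ _ ⟨
  s + (t ∸ suc f) C 2 + 2 * (t ∸ suc f)         ≈⟨ +-double-≡₂ _ (t ∸ suc f) ⟩
  s + (t ∸ suc f) C 2                           ∎
  where
  open ≡₂-Reasoning
  s = trueTailLengths w
  t = count id w
  f = count not w

mirrored : List Bool → List Bool
mirrored c = c ++ reverse (map not c)

count-mirrored : ∀ (p : Bool → Bool) → (∀ a → p (not a) ≡ not (p a)) → ∀ c →
  count p (mirrored c) ≡ length c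
count-mirrored p p-not c = begin
  count p (c ++ reverse (map not c))
    ≡⟨ count-++ p c (reverse (map not c)) ⟩
  count p c + count p (reverse (map not c))
    ≡⟨ cong (count p c +_) (trans (count-reverse p (map not c)) (count-map p not c)) ⟩
  count p c + count (p ∘ not) c
    ≡⟨ cong (count p c +_) (count-cong _ _ c (λ {a} _ → p-not a)) ⟩
  count p c + count (not ∘ p) c
    ≡⟨ count+count-not p c ⟩
  length c
    ∎
  where open ≡-Reasoning

trueTailLengths-∷ʳ : ∀ w z → trueTailLengths (w ∷ʳ z) ≡ trueTailLengths w + count id w
trueTailLengths-∷ʳ []          true  = refl
trueTailLengths-∷ʳ []          false = refl
trueTailLengths-∷ʳ (true ∷ w)  z = begin
  length (w ∷ʳ z) + trueTailLengths (w ∷ʳ z)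
    ≡⟨ cong₂ _+_ (length-++ w) (trueTailLengths-∷ʳ w z) ⟩
  length w + 1 + (trueTailLengths w + count id w)
    ≡⟨ rearrange (length w) (trueTailLengths w) (count id w) ⟩
  length w + trueTailLengths w + suc (count id w)
    ∎
  where
  open ≡-Reasoning
  rearrange : ∀ l t c → l + 1 + (t + c) ≡ l + t + suc c
  rearrange = solve-∀
trueTailLengths-∷ʳ (false ∷ w) z = trueTailLengths-∷ʳ w z

trueTailLengths-mirrored : ∀ c → trueTailLengths (mirrored c) ≡₂ length c C 2 + count id c
trueTailLengths-mirrored []      = ≡₂.refl
trueTailLengths-mirrored (a ∷ c) = begin
  trueTailLengths (mirrored (a ∷ c))
    ≡⟨ cong trueTailLengths unfold ⟩
  trueTailLengths (a ∷ mirrored c ∷ʳ not a)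
    ≡⟨ cong₂ _+_ (head a) (trueTailLengths-∷ʳ (mirrored c) (not a)) ⟩
  bit a * (2 * k + 1) + (trueTailLengths (mirrored c) + count id (mirrored c))
    ≈⟨ +-≡₂ (≡₂.refl {bit a * (2 * k + 1)}) (+-≡₂ (trueTailLengths-mirrored c) ≡₂.refl) ⟩
  bit a * (2 * k + 1) + (k C 2 + count id c + count id (mirrored c))
    ≡⟨ cong (λ t → bit a * (2 * k + 1) + (k C 2 + count id c + t)) (count-mirrored id (λ _ → refl) c) ⟩
  bit a * (2 * k + 1) + (k C 2 + count id c + k)
    ≡⟨ rearrange (bit a) k (k C 2) (count id c) ⟩
  k + k C 2 + (bit a + count id c) + 2 * (bit a * k)
    ≈⟨ +-double-≡₂ _ (bit a * k) ⟩
  k + k C 2 + (bit a + count id c)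
    ≡⟨ cong₂ _+_ (C2-suc k) (count-∷ id a c) ⟨
  suc k C 2 + count id (a ∷ c)
    ∎
  where
  open ≡₂-Reasoning
  k = length c
  rearrange : ∀ x k y z → x * (2 * k + 1) + (y + z + k) ≡ k + y + (x + z) + 2 * (x * k)
  rearrange = solve-∀
  unfold : mirrored (a ∷ c) ≡ a ∷ mirrored c ∷ʳ not a
  unfold = cong (a ∷_) (trans (cong (c ++_) (unfold-reverse (not a) (map not c))) (sym (++-assoc c _ _)))
  length-mirrored : length (mirrored c) ≡ k + k
  length-mirrored = trans (length-++ c) (cong (k +_) (trans (length-reverse (map not c)) (length-map not c)))
  head : ∀ a → (if a then length (mirrored c ∷ʳ not a) else 0) ≡ bit a * (2 * k + 1)
  head true  = trans (length-++ (mirrored c)) (trans (cong (_+ 1) length-mirrored) (double k))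
    where
    double : ∀ k → k + k + 1 ≡ 1 * (2 * k + 1)
    double = solve-∀
  head false = refl

layeredInversions-mirrored : ∀ c → layeredInversions (mirrored c) ≡₂ length c C 2 + count id c
layeredInversions-mirrored c = begin
  layeredInversions (mirrored c)
    ≈⟨ layeredInversions-≡₂ (mirrored c) ⟩
  trueTailLengths (mirrored c) + (count id (mirrored c) ∸ count not (mirrored c)) C 2
    ≡⟨ cong (λ d → trueTailLengths (mirrored c) + d C 2) balanced ⟩
  trueTailLengths (mirrored c) + 0
    ≡⟨ +-identityʳ _ ⟩
  trueTailLengths (mirrored c)
    ≈⟨ trueTailLengths-mirrored c ⟩
  length c C 2 + count id c
    ∎
  where
  open ≡₂-Reasoning
  balanced : count id (mirrored c) ∸ count not (mirrored c) ≡ 0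
  balanced = trans (cong₂ _∸_ (count-mirrored id (λ _ → refl) c) (count-mirrored not (λ _ → refl) c))
                   (n∸n≡0 (length c))

odd : ℕ → Bool
odd zero    = false
odd (suc n) = not (odd n)

odd-+-double : ∀ x a → odd (x + 2 * a) ≡ odd x
odd-+-double x zero    = cong odd (+-identityʳ x)
odd-+-double x (suc a) = begin
  odd (x + 2 * suc a)          ≡⟨ cong odd (shift x a) ⟩
  not (not (odd (x + 2 * a)))  ≡⟨ not-involutive _ ⟩
  odd (x + 2 * a)              ≡⟨ odd-+-double x a ⟩
  odd x                        ∎
  where
  open ≡-Reasoning
  shift : ∀ x a → x + 2 * suc a ≡ suc (suc (x + 2 * a))
  shift = solve-∀

onRunner0≡not-odd : ∀ x → onRunner0 x ≡ not (odd x)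
onRunner0≡not-odd zero          = refl
onRunner0≡not-odd (suc zero)    = refl
onRunner0≡not-odd (suc (suc x)) = begin
  (2 + x) % 2 ≡ᵇ 0    ≡⟨ cong (_≡ᵇ 0) (trans (cong (_% 2) (+-comm 2 x)) ([m+kn]%n≡m%n x 1 2)) ⟩
  onRunner0 x         ≡⟨ onRunner0≡not-odd x ⟩
  not (odd x)         ≡⟨ cong not (not-involutive (odd x)) ⟨
  not (odd (2 + x))   ∎
  where open ≡-Reasoning

onRunner0-mirror : ∀ n {j} → j < n → onRunner0 (n ∸ 1 ∸ j + n) ≡ odd j
onRunner0-mirror n {j} j<n = begin
  onRunner0 (a + n)              ≡⟨ onRunner0≡not-odd (a + n) ⟩
  not (odd (a + n))              ≡⟨ cong (not ∘ odd ∘ (a +_)) n≡ ⟨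
  not (odd (a + suc (a + j)))    ≡⟨ cong (not ∘ odd) (rearrange a j) ⟩
  not (odd (suc j + 2 * a))      ≡⟨ cong not (odd-+-double (suc j) a) ⟩
  not (not (odd j))              ≡⟨ not-involutive (odd j) ⟩
  odd j                          ∎
  where
  open ≡-Reasoning
  a = n ∸ 1 ∸ j
  n≡ : suc (a + j) ≡ n
  n≡ = trans (cong (λ x → suc (x + j)) (∸-+-assoc n 1 j)) (trans (sym (+-suc (n ∸ suc j) j)) (m∸n+n≡m j<n))
  rearrange : ∀ a j → a + suc (a + j) ≡ suc j + 2 * a
  rearrange = solve-∀

classes-ξ₁ : ∀ {n} (I : Vec Bool n) → map onRunner0 (ξ₁ I) ≡ mirrored (map odd (holes I))
classes-ξ₁ {n} I = begin
  map onRunner0 (map (_+ n) (holesᵒᵖ I) ++ reverse (holes I))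
    ≡⟨ map-++ onRunner0 (map (_+ n) (holesᵒᵖ I)) (reverse (holes I)) ⟩
  map onRunner0 (map (_+ n) (holesᵒᵖ I)) ++ map onRunner0 (reverse (holes I)) ≡⟨ cong₂ _++_ upper lower ⟩
  mirrored (map odd (holes I))
    ∎
  where
  open ≡-Reasoning
  upper : map onRunner0 (map (_+ n) (holesᵒᵖ I)) ≡ map odd (holes I)
  upper = begin
    map onRunner0 (map (_+ n) (holesᵒᵖ I))
      ≡⟨ cong (map onRunner0 ∘ map (_+ n)) (holesᵒᵖ≡ I) ⟩
    map onRunner0 (map (_+ n) (map (λ j → n ∸ 1 ∸ j) (holes I)))
      ≡⟨ trans (map-∘ (holes I)) (map-∘ (map (λ j → n ∸ 1 ∸ j) (holes I))) ⟨
    map (λ j → onRunner0 (n ∸ 1 ∸ j + n)) (holes I)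
      ≡⟨ map-cong-local (All.map (onRunner0-mirror n) (holes-bound I)) ⟩
    map odd (holes I)
      ∎
  lower : map onRunner0 (reverse (holes I)) ≡ reverse (map not (map odd (holes I)))
  lower = begin
    map onRunner0 (reverse (holes I))        ≡⟨ reverse-map onRunner0 (holes I) ⟩
    reverse (map onRunner0 (holes I))        ≡⟨ cong reverse (map-cong onRunner0≡not-odd (holes I)) ⟩
    reverse (map (not ∘ odd) (holes I))      ≡⟨ cong reverse (map-∘ (holes I)) ⟩
    reverse (map not (map odd (holes I)))    ∎

∣∷∣ : ∀ {n} b (I : Subset n) → ∣ b ∷ I ∣ ≡ bit b + ∣ I ∣
∣∷∣ true  I = refl
∣∷∣ false I = refl

length-holes : ∀ {n} (I : Vec Bool n) → length (holes I) + ∣ I ∣ ≡ n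
length-holes []          = refl
length-holes (true ∷ I)  =
  trans (+-suc _ ∣ I ∣) (cong suc (trans (cong (_+ ∣ I ∣) (length-map suc (holes I))) (length-holes I)))
length-holes (false ∷ I) = cong suc (trans (cong (_+ ∣ I ∣) (length-map suc (holes I))) (length-holes I))

length-toList : ∀ {n} (I : Vec Bool n) → length (toList I) ≡ n
length-toList []      = refl
length-toList (b ∷ I) = cong suc (length-toList I)

count-toList : ∀ {n} (I : Vec Bool n) → count id (toList I) ≡ ∣ I ∣
count-toList []      = refl
count-toList (b ∷ I) =
  trans (count-∷ id b (toList I)) (trans (cong (bit b +_) (count-toList I)) (sym (∣∷∣ b I)))

count-odd-holes-∷ : ∀ {n} b (I : Vec Bool n) → count odd (holes (b ∷ I)) ≡ count (not ∘ odd) (holes I)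
count-odd-holes-∷ true  I = count-map odd suc (holes I)
count-odd-holes-∷ false I = count-map odd suc (holes I)

trueTailLengths+oddHoles : ∀ {n} (I : Vec Bool n) →
  trueTailLengths (toList I) + count odd (holes I) ≡₂ ∣ I ∣ * n + ∣ I ∣ + n C 2
trueTailLengths+oddHoles []              = ≡₂.refl
trueTailLengths+oddHoles {suc n} (b ∷ I) = begin
  (if b then length (toList I) else 0) + s + count odd (holes (b ∷ I))
    ≡⟨ cong₂ (λ x y → x + s + y) (head b) (count-odd-holes-∷ b I) ⟩
  bit b * n + s + Q′
    ≈⟨ +-double-≡₂ _ Q ⟨
  bit b * n + s + Q′ + 2 * Q
    ≡⟨ rearrange₁ (bit b * n) s Q Q′ ⟩
  bit b * n + (s + Q) + (Q + Q′)
    ≡⟨ cong (bit b * n + (s + Q) +_) (count+count-not odd (holes I)) ⟩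
  bit b * n + (s + Q) + length (holes I)
    ≈⟨ +-double-≡₂ _ m ⟨
  bit b * n + (s + Q) + length (holes I) + 2 * m
    ≡⟨ rearrange₂ (bit b * n) (s + Q) (length (holes I)) m ⟩
  bit b * n + (s + Q) + (length (holes I) + m) + m
    ≡⟨ cong (λ l → bit b * n + (s + Q) + l + m) (length-holes I) ⟩
  bit b * n + (s + Q) + n + m
    ≈⟨ +-≡₂ (+-≡₂ (+-≡₂ (≡₂.refl {bit b * n}) (trueTailLengths+oddHoles I)) (≡₂.refl {n})) (≡₂.refl {m}) ⟩
  bit b * n + (m * n + m + n C 2) + n + m
    ≈⟨ +-double-≡₂ _ (bit b) ⟨
  bit b * n + (m * n + m + n C 2) + n + m + 2 * bit b
    ≡⟨ rearrange₃ (bit b) m n (n C 2) ⟩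
  (bit b + m) * suc n + (bit b + m) + (n + n C 2)
    ≡⟨ cong₂ (λ m′ c → m′ * suc n + m′ + c) (∣∷∣ b I) (C2-suc n) ⟨
  ∣ b ∷ I ∣ * suc n + ∣ b ∷ I ∣ + suc n C 2
    ∎
  where
  open ≡₂-Reasoning
  s  = trueTailLengths (toList I)
  Q  = count odd (holes I)
  Q′ = count (not ∘ odd) (holes I)
  m  = ∣ I ∣
  head : ∀ b → (if b then length (toList I) else 0) ≡ bit b * n
  head true  = trans (length-toList I) (sym (+-identityʳ n))
  head false = refl
  rearrange₁ : ∀ x t q q′ → x + t + q′ + 2 * q ≡ x + (t + q) + (q + q′)
  rearrange₁ = solve-∀
  rearrange₂ : ∀ x y l m → x + y + l + 2 * m ≡ x + y + (l + m) + m
  rearrange₂ = solve-∀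
  rearrange₃ : ∀ c m n d → c * n + (m * n + m + d) + n + m + 2 * c ≡ (c + m) * suc n + (c + m) + (n + d)
  rearrange₃ = solve-∀

signExponent : ℕ → ℕ → ℕ
signExponent n m = (n ∸ m) C 2 + (m ∸ (n ∸ m)) C 2 + (m * n + m + n C 2)

classExponent : ∀ {n} → Vec Bool n → ℕ
classExponent I = layeredInversions (map onRunner0 (ξ₁ I)) + layeredInversions (map onRunner2 (μ I))

classExponent-≡₂ : ∀ {n} (I : Vec Bool n) → classExponent I ≡₂ signExponent n ∣ I ∣
classExponent-≡₂ {n} I = begin
  layeredInversions (map onRunner0 (ξ₁ I)) + layeredInversions (map onRunner2 (μ I))
    ≡⟨ cong₂ (λ u v → layeredInversions u + layeredInversions v) (classes-ξ₁ I) (classes-μ I) ⟩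
  layeredInversions (mirrored c) + layeredInversions (toList I)
    ≈⟨ +-≡₂ (layeredInversions-mirrored c) (layeredInversions-≡₂ (toList I)) ⟩
  length c C 2 + count id c + (s + (count id (toList I) ∸ count not (toList I)) C 2)
    ≡⟨ cong₂ (λ l t → l C 2 + count id c + (s + t C 2)) length-c (cong₂ _∸_ (count-toList I) count-not) ⟩
  (n ∸ m) C 2 + count id c + (s + (m ∸ (n ∸ m)) C 2)
    ≡⟨ cong (λ q → (n ∸ m) C 2 + q + (s + (m ∸ (n ∸ m)) C 2)) (count-map id odd (holes I)) ⟩
  (n ∸ m) C 2 + Q + (s + (m ∸ (n ∸ m)) C 2)
    ≡⟨ rearrange ((n ∸ m) C 2) Q s ((m ∸ (n ∸ m)) C 2) ⟩
  (n ∸ m) C 2 + (m ∸ (n ∸ m)) C 2 + (s + Q)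
    ≈⟨ +-≡₂ (≡₂.refl {(n ∸ m) C 2 + (m ∸ (n ∸ m)) C 2}) (trueTailLengths+oddHoles I) ⟩
  signExponent n m
    ∎
  where
  open ≡₂-Reasoning
  m = ∣ I ∣
  c = map odd (holes I)
  s = trueTailLengths (toList I)
  Q = count odd (holes I)
  length-c : length c ≡ n ∸ m
  length-c = trans (length-map odd (holes I))
                   (trans (sym (m+n∸n≡m (length (holes I)) m)) (cong (_∸ m) (length-holes I)))
  count-not : count not (toList I) ≡ n ∸ m
  count-not = trans (sym (m+n∸m≡n (count id (toList I)) _))
                    (cong₂ _∸_ (trans (count+count-not id (toList I)) (length-toList I)) (count-toList I))
  rearrange : ∀ a q t b → a + q + (t + b) ≡ a + b + (t + q)
  rearrange = solve-∀

private
  *-comm-2 : ∀ m → 2 * m ≡ m + m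
  *-comm-2 m = cong (m +_) (+-identityʳ m)

square+self-≡₂ : ∀ d → d * d + d ≡₂ 0
square+self-≡₂ d = begin
  d * d + d    ≈⟨ +-≡₂ (square-≡₂ d) (≡₂.refl {d}) ⟩
  d + d        ≡⟨ cong (d +_) (+-identityʳ d) ⟨
  0 + 2 * d    ≈⟨ +-double-≡₂ 0 d ⟩
  0            ∎
  where open ≡₂-Reasoning

signExponent-2m≤ℓ : ∀ {n m} → 2 * m ≤ n → signExponent n m ≡₂ m C 2
signExponent-2m≤ℓ {n} {m} 2m≤n with m≤n⇒∃[o]m+o≡n (≤-trans (m≤m+n m (m + 0)) 2m≤n)
... | k , refl = begin
  (m + k ∸ m) C 2 + (m ∸ (m + k ∸ m)) C 2 + (m * (m + k) + m + (m + k) C 2)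
    ≡⟨ cong₂ (λ k′ d → k′ C 2 + d C 2 + (m * (m + k) + m + (m + k) C 2))
             (m+n∸m≡n m k) (trans (cong (m ∸_) (m+n∸m≡n m k)) (m≤n⇒m∸n≡0 m≤k)) ⟩
  k C 2 + 0 + (m * (m + k) + m + (m + k) C 2)
    ≡⟨ cong (λ c → k C 2 + 0 + (m * (m + k) + m + c)) (C2-+ m k) ⟩
  k C 2 + 0 + (m * (m + k) + m + (m C 2 + k C 2 + m * k))
    ≡⟨ rearrange m k (m C 2) (k C 2) ⟩
  m C 2 + (m * m + m) + 2 * (k C 2 + m * k)
    ≈⟨ +-double-≡₂ _ (k C 2 + m * k) ⟩
  m C 2 + (m * m + m)
    ≈⟨ +-≡₂ (≡₂.refl {m C 2}) (square+self-≡₂ m) ⟩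
  m C 2 + 0
    ≡⟨ +-identityʳ (m C 2) ⟩
  m C 2
    ∎
  where
  open ≡₂-Reasoning
  m≤k : m ≤ k
  m≤k = +-cancelˡ-≤ m m k (≤-trans (≤-reflexive (sym (*-comm-2 m))) 2m≤n)
  rearrange : ∀ m k x y → y + 0 + (m * (m + k) + m + (x + y + m * k)) ≡ x + (m * m + m) + 2 * (y + m * k)
  rearrange = solve-∀

signExponent-ℓ≤2m : ∀ {n m} → m ≤ n → n ≤ 2 * m →
  signExponent n m ≡₂ ((n ∸ m) + 1) C 2 + (n ∸ m) * m
signExponent-ℓ≤2m {n} {m} m≤n n≤2m with m≤n⇒∃[o]m+o≡n m≤n
... | k , refl with m≤n⇒∃[o]m+o≡n (+-cancelˡ-≤ m k m (≤-trans n≤2m (≤-reflexive (*-comm-2 m))))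
... | d , refl = begin
  (k + d + k ∸ (k + d)) C 2 + (k + d ∸ (k + d + k ∸ (k + d))) C 2
    + ((k + d) * (k + d + k) + (k + d) + (k + d + k) C 2)
    ≡⟨ cong₂ (λ k′ d′ → k′ C 2 + d′ C 2 + ((k + d) * (k + d + k) + (k + d) + (k + d + k) C 2)) k≡ d≡ ⟩
  k C 2 + d C 2 + ((k + d) * (k + d + k) + (k + d) + (k + d + k) C 2)
    ≡⟨ cong (λ c → k C 2 + d C 2 + ((k + d) * (k + d + k) + (k + d) + c))
            (trans (C2-+ (k + d) k) (cong (λ c → c + k C 2 + (k + d) * k) (C2-+ k d))) ⟩
  k C 2 + d C 2 + ((k + d) * (k + d + k) + (k + d) + (k C 2 + d C 2 + k * d + k C 2 + (k + d) * k))
    ≡⟨ rearrange k d (k C 2) (d C 2) ⟩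
  k + k C 2 + k * (k + d) + (d * d + d) + 2 * (k C 2 + d C 2 + k * k + 2 * k * d)
    ≈⟨ +-double-≡₂ _ (k C 2 + d C 2 + k * k + 2 * k * d) ⟩
  k + k C 2 + k * (k + d) + (d * d + d)
    ≈⟨ +-≡₂ (≡₂.refl {k + k C 2 + k * (k + d)}) (square+self-≡₂ d) ⟩
  k + k C 2 + k * (k + d) + 0
    ≡⟨ +-identityʳ _ ⟩
  k + k C 2 + k * (k + d)
    ≡⟨ cong (λ c → c + k * (k + d)) (trans (cong (_C 2) (+-comm k 1)) (C2-suc k)) ⟨
  (k + 1) C 2 + k * (k + d)
    ≡⟨ cong (λ k′ → (k′ + 1) C 2 + k′ * (k + d)) k≡ ⟨
  ((k + d + k ∸ (k + d)) + 1) C 2 + (k + d + k ∸ (k + d)) * (k + d)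
    ∎
  where
  open ≡₂-Reasoning
  k≡ : k + d + k ∸ (k + d) ≡ k
  k≡ = m+n∸m≡n (k + d) k
  d≡ : k + d ∸ (k + d + k ∸ (k + d)) ≡ d
  d≡ = trans (cong (k + d ∸_) k≡) (m+n∸m≡n k d)
  rearrange : ∀ k d x y → x + y + ((k + d) * (k + d + k) + (k + d) + (x + y + k * d + x + (k + d) * k))
                        ≡ k + x + k * (k + d) + (d * d + d) + 2 * (x + y + k * k + 2 * k * d)
  rearrange = solve-∀

signProduct : ∀ {n} b (I : Vec Bool n) →
  delta2 (barQuot1 (addNodes (suc n) (b ∷ I))) ℤ.* delta3bar (addNodes (suc n) (b ∷ I)) ≡ sgn (classExponent (b ∷ I))
signProduct {n} b I = begin
  delta2 (barQuot1 (addNodes (suc n) (b ∷ I))) ℤ.* delta3bar (addNodes (suc n) (b ∷ I))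
    ≡⟨ cong (λ λs → delta2 (barQuot1 λs) ℤ.* delta3bar λs) {addNodes (suc n) (b ∷ I)} {μ (b ∷ I)} (addNodes≡μ (suc n) (b ∷ I)) ⟩
  delta2 (barQuot1 (μ (b ∷ I))) ℤ.* delta3bar (μ (b ∷ I))
    ≡⟨ cong₂ ℤ._*_ {delta2 (barQuot1 (μ (b ∷ I)))} {sgn G₂} {delta3bar (μ (b ∷ I))} {sgn G₃} δ₂ δ̄₃ ⟩
  sgn G₂ ℤ.* sgn G₃
    ≡⟨ sgn-+ G₂ G₃ ⟨
  sgn (G₂ + G₃)
    ∎
  where
  -- The implicit arguments of cong and cong₂ are given: inferring them makes Agda unfold delta2.
  open ≡-Reasoning
  G₂ = layeredInversions (map onRunner0 (ξ₁ (b ∷ I)))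
  G₃ = layeredInversions (map onRunner2 (μ (b ∷ I)))
  δ₂ : delta2 (barQuot1 (μ (b ∷ I))) ≡ sgn G₂
  δ₂ = begin
    delta2 (barQuot1 (μ (b ∷ I)))
      ≡⟨ cong delta2 (barQuot1-μ b I) ⟩
    delta2 (β⁻¹ (ξ₁ (b ∷ I)))
      ≡⟨ delta2-β⁻¹ (ξ₁ (b ∷ I)) (length (holes (b ∷ I))) (length-ξ₁ (b ∷ I)) (decreasing-ξ₁ (b ∷ I)) ⟩
    numberingSign (ξ₁ (b ∷ I)) (layerNumber (ξ₁ (b ∷ I)))
      ≡⟨ layerSign (ξ₁ (b ∷ I)) (decreasing-ξ₁ (b ∷ I)) ⟩
    sgn G₂
      ∎
  δ̄₃ : delta3bar (μ (b ∷ I)) ≡ sgn G₃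
  δ̄₃ = barSign (μ (b ∷ I)) (decreasing-μ (b ∷ I)) (offRunner0-μ (b ∷ I))

lemma6p7 : (ℓ m : ℕ) → 1 ≤ ℓ → m ≤ ℓ → (I : Subset ℓ) → ∣ I ∣ ≡ m →
  ((2 * m ≤ ℓ →
      delta2 (barQuot1 (addNodes ℓ I)) Data.Integer.* delta3bar (addNodes ℓ I) ≡ sgn (m C 2))
  × (ℓ ≤ 2 * m →
      delta2 (barQuot1 (addNodes ℓ I)) Data.Integer.* delta3bar (addNodes ℓ I)
        ≡ sgn (((ℓ ∸ m) + 1) C 2 + (ℓ ∸ m) * m)))
lemma6p7 (suc n) m _ m≤ℓ (b ∷ I) ∣I∣≡m =
    (λ 2m≤ℓ → signs (signExponent-2m≤ℓ {suc n} {m} 2m≤ℓ))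
  , (λ ℓ≤2m → signs (signExponent-ℓ≤2m {suc n} {m} m≤ℓ ℓ≤2m))
  where
  exponent : classExponent (b ∷ I) ≡₂ signExponent (suc n) m
  exponent = subst (λ m → classExponent (b ∷ I) ≡₂ signExponent (suc n) m) ∣I∣≡m (classExponent-≡₂ (b ∷ I))
  signs : ∀ {e} → signExponent (suc n) m ≡₂ e →
    delta2 (barQuot1 (addNodes (suc n) (b ∷ I))) ℤ.* delta3bar (addNodes (suc n) (b ∷ I)) ≡ sgn e
  signs e≡ = trans (signProduct b I) (sgn-≡₂ (≡₂.trans exponent e≡))
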